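{- For all positive integers $d$ and $m$, \[ P_{d^m} = \sum_{\lambda\vdash d}(-1)^{\ell(\lambda)-1}\frac{d}{\ell(\lambda)}\binom{\ell(\lambda)}{m_1(\lambda), m_2(\lambda), \ldots} H_{m\lambda} \qquad\text{and}\qquad P_{d^m} = \sum_{\lambda\vdash d}(-1)^{\ell(\lambda)}\frac{d}{\ell(\lambda)}\binom{\ell(\lambda)}{m_1(\lambda), m_2(\lambda), \ldots} E_{m\lambda}, \] where the sums range over all (ordinary) partitions $\lambda$ of $d$.
   Context: $\mathsf{P\Lambda}$ denotes the $\mathbb{Q}$-algebra of polysymmetric functions: formal power series of bounded degree in variables $x_{i,j}$ ($i,j\ge1$), $x_{i,j}$ of degree $i$, invariant under every permutation of $x_{i,1},x_{i,2},\dots$ for each fixed $i$. A stack is a pair of positive integers $d^m$; a stack partition $\tau\Vdash n$ is a finite weakly decreasing sequence of stacks $(d_1^{m_1},\dots,d_s^{m_s})$ with $\sum d_im_i=n$; an ordinary partition $\lambda\vdash n$ has all multiplicities $1$ and is identified with its list of parts $(\lambda_1,\dots,\lambda_k)$; $\ell(\lambda)=k$ and $m_i(\lambda)$ is the number of parts of $\lambda$ equal to $i$. $M_\tau=\sum_\alpha x_{d_1,\alpha_1}^{m_1}\cdots x_{d_s,\alpha_s}^{m_s}$ over sequences $\alpha$ of positive integers with $\alpha_i\ne\alpha_j$ whenever $d_i=d_j$, $i\ne j$. Define $H_d=\sum_{\alpha\Vdash d}M_\alpha$, $E_d=\sum_{\alpha\vdash d}(-1)^{\ell(\alpha)}M_\alpha$,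 $P_d=\sum_{k\mid d}kM_{k^{d/k}}$. For each such $F$, $F_{d^m}$ is $F_d$ with each $x_{i,j}$ replaced by $x_{i,j}^m$, and for $\lambda=(\lambda_1,\dots,\lambda_k)$, $m\lambda$ denotes the stack partition $(\lambda_1^m,\dots,\lambda_k^m)$, so $F_{m\lambda}=\prod_i F_{\lambda_i^m}$. -}

module Defs where

open import Data.Bool using (Bool; true; false; if_then_else_; _∧_)
open import Data.Nat as ℕ using (ℕ; zero; suc; _≤_; _≡ᵇ_; _≤ᵇ_; _∸_; NonZero; _!; _%_)
open import Data.Nat.Properties using (_!≢0; m*n≢0)
open import Data.Nat.Divisibility using (_∣?_)
open import Data.Integer using (+_)
open import Data.Rational as Q using (ℚ; 0ℚ; 1ℚ)
open import Data.List using (List; []; _∷_; map; _++_; concatMap; foldr; length; upTo; filterᵇ; applyUpTo)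
open import Data.List.Relation.Unary.All using (All)
open import Data.List.Relation.Unary.Unique.Propositional using (Unique)
open import Data.Product using (_×_; _,_; proj₁; proj₂)
open import Relation.Binary.PropositionalEquality using (_≡_)
open import Relation.Nullary.Decidable using (does)

-- An entry (i , j , e) stands for x_{i,j}^e.  A (well-formed) monomial
-- is a list of entries at pairwise distinct positions (i , j) with
-- i , j ≥ 1; entries with e = 0 are allowed (they stand for 1).  Every
-- coefficient function defined below depends only on the monomial
-- itself (not on the order of entries nor on zero-exponent entries).

Entry : Set
Entry = ℕ × ℕ × ℕ

Mono : Set
Mono = List Entry

pos : Entry → ℕ × ℕ
pos (i , j , e) = (i , j)

ValidEntry : Entry → Set
ValidEntry (i , j , e) = (1 ≤ i) × (1 ≤ j)

WFMono : Mono → Set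
WFMono μ = All ValidEntry μ × Unique (map pos μ)

-- Formal power series with rational coefficients, given by their
-- coefficient function on monomials (elements of PΛ are such series).

Series : Set
Series = Mono → ℚ

allB : {A : Set} → (A → Bool) → List A → Bool
allB p [] = true
allB p (x ∷ xs) = p x ∧ allB p xs

infix 4 _≈S_
_≈S_ : Series → Series → Set
F ≈S G = (μ : Mono) → WFMono μ → F μ ≡ G μ

zeroS : Series
zeroS μ = 0ℚ

isOne : Mono → Bool
isOne μ = allB (λ { (i , j , e) → e ≡ᵇ 0 }) μ

oneS : Series
oneS μ = if isOne μ then 1ℚ else 0ℚ

_⊕_ : Series → Series → Series
(F ⊕ G) μ = F μ Q.+ G μ

_·_ : ℚ → Series → Series
(c · F) μ = c Q.* F μ

-- all ways of writing μ = ν ρ (as exponent vectors, entrywise e = a + (e ∸ a))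
splits : Mono → List (Mono × Mono)
splits [] = ([] , []) ∷ []
splits ((i , j , e) ∷ μ) =
  concatMap (λ a → map (λ { (ν , ρ) → ((i , j , a) ∷ ν , (i , j , e ∸ a) ∷ ρ) }) (splits μ))
            (upTo (suc e))

sumℚ : List ℚ → ℚ
sumℚ = foldr Q._+_ 0ℚ

_⊗_ : Series → Series → Series
(F ⊗ G) μ = sumℚ (map (λ { (ν , ρ) → F ν Q.* G ρ }) (splits μ))

sumS : List Series → Series
sumS = foldr _⊕_ zeroS

prodS : List Series → Series
prodS = foldr _⊗_ oneS

-- Substitution x_{i,j} ↦ x_{i,j}^m  (for m ≥ 1):
-- coefficient at μ is F(μ with exponents divided by m) if m divides all
-- exponents of μ, and 0 otherwise.

substPow : ℕ → Series → Series
substPow zero F μ = 0ℚ   -- not used (m ≥ 1 throughout)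
substPow (suc k) F μ =
  if allB (λ { (i , j , e) → (e % suc k) ≡ᵇ 0 }) μ
  then F (map (λ { (i , j , e) → (i , j , e ℕ./ suc k) }) μ)
  else 0ℚ

-- Stacks d^m are pairs (d , m); stack partitions are lists of stacks.

Stack : Set
Stack = ℕ × ℕ

_≡ᵇS_ : Stack → Stack → Bool
(a , b) ≡ᵇS (c , d) = (a ≡ᵇ c) ∧ (b ≡ᵇ d)

countS : Stack → List Stack → ℕ
countS s l = length (filterᵇ (s ≡ᵇS_) l)

sameMultiset : List Stack → List Stack → Bool
sameMultiset A B = allB (λ s → countS s A ≡ᵇ countS s B) (A ++ B)

monoType : Mono → List Stack
monoType [] = []
monoType ((i , j , zero) ∷ μ) = monoType μ
monoType ((i , j , suc e) ∷ μ) = (i , suc e) ∷ monoType μ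

-- monomial polysymmetric function M_τ: sum of all distinct monomials
-- of the form x_{d_1,α_1}^{m_1} ⋯ x_{d_s,α_s}^{m_s} (α_i ≠ α_j when
-- d_i = d_j), i.e. coefficient 1 exactly at monomials of type τ.
M : List Stack → Series
M τ μ = if sameMultiset (monoType μ) τ then 1ℚ else 0ℚ

-- Enumeration of stack partitions.
-- sp fuel n cands : all lists of stacks, weakly decreasing with respect
-- to the order of the candidate list cands (each next stack is the same
-- as, or later in cands than, the previous), with total weight n.

weight : Stack → ℕ
weight (d , m) = d ℕ.* m

sp : ℕ → ℕ → List Stack → List (List Stack)
sp _ zero _ = [] ∷ []
sp zero (suc n) _ = []
sp (suc f) (suc n) [] = []
sp (suc f) (suc n) (s ∷ rest) =
  (if weight s ≤ᵇ suc n
   then map (s ∷_) (sp f (suc n ∸ weight s) (s ∷ rest))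
   else [])
  ++ sp (suc f) (suc n) rest

stacksUpTo : ℕ → List Stack
stacksUpTo n = concatMap (λ d → map (λ m → (suc d , suc m)) (upTo n)) (upTo n)

-- all stack partitions τ ⊩ n (each multiset of stacks exactly once)
stackPartitions : ℕ → List (List Stack)
stackPartitions n = sp n n (stacksUpTo n)

-- all ordinary partitions λ ⊢ n, as weakly decreasing lists of parts
partitions : ℕ → List (List ℕ)
partitions n = map (map proj₁) (sp n n (map (λ k → (k , 1)) (Data.List.reverse (applyUpTo suc n))))

asStacks : List ℕ → List Stack
asStacks λ' = map (λ k → (k , 1)) λ'

H : ℕ → Series
H d = sumS (map M (stackPartitions d))

sign : ℕ → ℚ
sign zero = 1ℚ
sign (suc n) = Q.- sign n

E : ℕ → Series
E d = sumS (map (λ α → sign (length α) · M (asStacks α)) (partitions d))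

ℕtoℚ : ℕ → ℚ
ℕtoℚ n = + n Q./ 1

-- P_d = Σ_{k ∣ d} k M_{k^{d/k}}
P : ℕ → Series
P d = sumS (map (λ k → ℕtoℚ (suc k) · M ((suc k , d ℕ./ suc k) ∷ []))
                (filterᵇ (λ k → does (suc k ∣? d)) (upTo d)))

-- F_{mλ} = ∏_i F_{λ_i^m}
atStack : (ℕ → Series) → ℕ → List ℕ → Series
atStack F m λ' = prodS (map (λ k → substPow m (F k)) λ')

mult : ℕ → List ℕ → ℕ
mult i λ' = length (filterᵇ (i ≡ᵇ_) λ')

-- (m_1(λ), …, m_n(λ)) for n = |λ| (all m_i with i > |λ| vanish)
multiplicities : ℕ → List ℕ → List ℕ
multiplicities n λ' = map (λ i → mult (suc i) λ') (upTo n)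

prodFact : List ℕ → ℕ
prodFact [] = 1
prodFact (k ∷ ks) = k ! ℕ.* prodFact ks

prodFact≢0 : (ks : List ℕ) → NonZero (prodFact ks)
prodFact≢0 [] = _
prodFact≢0 (k ∷ ks) = m*n≢0 (k !) (prodFact ks) {{k !≢0}} {{prodFact≢0 ks}}

multinomial : ℕ → List ℕ → ℕ
multinomial ℓ ks = (ℓ ! ℕ./ prodFact ks) {{prodFact≢0 ks}}

-- the rational number a / b (b ≥ 1 in all uses; 0 if b = 0)
frac : ℕ → ℕ → ℚ
frac a zero = 0ℚ
frac a (suc b) = + a Q./ suc b

-- coefficient  (d / ℓ(λ)) · (ℓ(λ) ; m_1(λ), m_2(λ), …)  (without sign)
coeff : ℕ → List ℕ → ℚ
coeff d λ' = frac d (length λ') Q.* ℕtoℚ (multinomial (length λ') (multiplicities d λ'))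

{-# OPTIONS --safe #-}
module Submission where

-- Let Hgen = ∑_d H_d = ∏ (1 - x_{i,j})⁻¹, Egen = ∑_d E_d = ∏ (1 - x_{i,j}) and Pgen = ∑_d P_d, and let D be
-- the Euler derivation, multiplying the coefficient of a monomial by its degree.  Then D Hgen = Pgen·Hgen
-- and D Egen = -Pgen·Egen, so Pgen = ±D log B for B = Hgen, Egen.  Writing B = 1 + X with X = B₁ + B₂ + ⋯
-- (B_k the degree-k part, i.e. H_k or E_k) and log (1 + X) = ∑_ℓ (-1)^{ℓ-1} X^ℓ / ℓ, the degree-d part of
-- D log B is that of ∑_ℓ (-1)^{ℓ-1} (d/ℓ) X^ℓ, and the multinomial theorem expands X^ℓ as a sum over the
-- partitions λ of d with ℓ parts of (ℓ; m₁(λ), m₂(λ), …) B_{λ₁} ⋯ B_{λ_ℓ}.  This is the case m = 1; the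
-- substitution x ↦ x^m is a ring endomorphism of the series, taking P_d, H_k, E_k to P_{d^m}, H_{k^m}, E_{k^m}.

open import Defs
open import Algebra.Bundles using (CommutativeMonoid; CommutativeSemiring)
import Algebra.Construct.Pointwise as Pointwise
open import Algebra.Structures.Biased using (IsCommutativeSemiringˡ)
open import Data.Bool as Bool using (Bool; true; false; if_then_else_; _∧_; not)
open import Data.Bool.Properties using (T-∧)
open import Data.Empty using (⊥-elim)
open import Data.Fin using (toℕ)
import Data.Integer as ℤ
import Data.Integer.Properties as ℤₚ
open import Data.List
  using (List; []; _∷_; map; _++_; length; null; replicate; concatMap; upTo; applyUpTo; applyDownFrom;
         cartesianProductWith; filterᵇ)
import Data.List.Properties as Listₚ
open import Data.List.Membership.Propositional using (_∈_; _∉_; find)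
import Data.List.Membership.Propositional.Properties as ∈ₚ
open import Data.List.Relation.Unary.All as All using (All; []; _∷_)
import Data.List.Relation.Unary.All.Properties as Allₚ
open import Data.List.Relation.Unary.AllPairs using ([]; _∷_)
open import Data.List.Relation.Unary.Any using (here; there)
open import Data.List.Relation.Unary.Unique.Propositional using (Unique)
import Data.List.Relation.Unary.Unique.Propositional.Properties as Uniqueₚ
open import Data.Nat as ℕ using (ℕ; zero; suc; _∸_; _≤_; _<_; _≡ᵇ_; _≤ᵇ_; _%_; _/_; _!; NonZero; z≤n; s≤s)
import Data.Nat.Coprimality as Coprime
open import Data.Nat.Combinatorics using (_C_; k![n∸k]!∣n!)
open import Data.Nat.Combinatorics.Specification using (nCk≡n!/k![n-k]!)
open import Data.Nat.Divisibility
  using (_∣_; _∣?_; ∣-refl; ∣-trans; *-monoʳ-∣; m∣m*n; ∣m∣n⇒∣m+n; m%n≡0⇒n∣m; n∣m⇒m%n≡0)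
import Data.Nat.DivMod as DivMod
open import Data.Nat.ListAction using (sum)
import Data.Nat.Properties as ℕₚ
open import Data.Product using (_×_; _,_; proj₁; proj₂; ∃)
open import Data.Product.Properties using (,-injective)
open import Data.Rational using (ℚ; 0ℚ; 1ℚ; mkℚ; _+_; _*_; -_; 1/_; toℚᵘ)
import Data.Rational.Properties as ℚₚ
open import Data.Rational.Solver using (module +-*-Solver)
open import Data.Rational.Unnormalised as ℚᵘ using (mkℚᵘ; *≡*)
import Data.Rational.Unnormalised.Properties as ℚᵘₚ
open import Data.Sum using (inj₁; inj₂; [_,_]′)
open import Function using (_∘_; id; Equivalence)
open import Relation.Binary.Bundles using (Setoid)
open import Relation.Binary.Definitions using (DecidableEquality)
open import Relation.Binary.PropositionalEquality
import Relation.Binary.Reasoning.Setoid as SetoidReasoning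
open import Relation.Nullary using (¬_; Dec; yes; no; does)
open import Relation.Nullary.Decidable as Dec using (_×-dec_; T?)
open import Relation.Nullary.Negation using (contradiction)
open import Relation.Nullary.Reflects using (Reflects; ofʸ; ofⁿ; fromEquivalence; det)
open import Algebra.Properties.CommutativeSemigroup
  (CommutativeMonoid.commutativeSemigroup ℚₚ.+-0-commutativeMonoid) using () renaming (interchange to +-interchange)
open import Algebra.Properties.CommutativeSemigroup ℕₚ.+-commutativeSemigroup
  using () renaming (interchange to ℕ-+-interchange; x∙yz≈y∙xz to x+[y+z]≡y+[x+z])
open import Algebra.Properties.CommutativeSemigroup ℕₚ.*-commutativeSemigroup
  using () renaming (x∙yz≈y∙xz to x*[y*z]≡y*[x*z])

open +-*-Solver using (solve; _:=_; _:+_; _:*_; :-_; con)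

-- Natural numbers as rationals

-- Opened only here: with the integer +_ in scope, sections such as (x +_) become ambiguous.
module _ where
  open import Data.Integer using (+_)

  ℕtoℚ≡mkℚ : ∀ n → ℕtoℚ n ≡ mkℚ (+ n) 0 (Coprime.sym (Coprime.1-coprimeTo n))
  ℕtoℚ≡mkℚ n = ℚₚ.↥p/↧p≡p _

  toℚᵘ-ℕtoℚ : ∀ n → toℚᵘ (ℕtoℚ n) ℚᵘ.≃ mkℚᵘ (+ n) 0
  toℚᵘ-ℕtoℚ n = ℚᵘₚ.≃-reflexive (cong toℚᵘ (ℕtoℚ≡mkℚ n))

  ℕtoℚ-+ : ∀ a b → ℕtoℚ (a ℕ.+ b) ≡ ℕtoℚ a + ℕtoℚ b
  ℕtoℚ-+ a b = ℚₚ.toℚᵘ-injective (begin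
    toℚᵘ (ℕtoℚ (a ℕ.+ b))              ≈⟨ toℚᵘ-ℕtoℚ (a ℕ.+ b) ⟩
    mkℚᵘ (+ (a ℕ.+ b)) 0               ≈⟨ *≡* eq ⟩
    mkℚᵘ (+ a) 0 ℚᵘ.+ mkℚᵘ (+ b) 0     ≈⟨ ℚᵘₚ.+-cong (toℚᵘ-ℕtoℚ a) (toℚᵘ-ℕtoℚ b) ⟨
    toℚᵘ (ℕtoℚ a) ℚᵘ.+ toℚᵘ (ℕtoℚ b)   ≈⟨ ℚₚ.toℚᵘ-homo-+ (ℕtoℚ a) (ℕtoℚ b) ⟨
    toℚᵘ (ℕtoℚ a + ℕtoℚ b)             ∎)
    where
    open ℚᵘₚ.≃-Reasoning
    eq : + (a ℕ.+ b) ℤ.* + 1 ≡ (+ a ℤ.* + 1 ℤ.+ + b ℤ.* + 1) ℤ.* + 1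
    eq rewrite ℤₚ.*-identityʳ (+ a) | ℤₚ.*-identityʳ (+ b) = cong (ℤ._* + 1) (ℤₚ.pos-+ a b)

  ℕtoℚ-* : ∀ a b → ℕtoℚ (a ℕ.* b) ≡ ℕtoℚ a * ℕtoℚ b
  ℕtoℚ-* a b = ℚₚ.toℚᵘ-injective (begin
    toℚᵘ (ℕtoℚ (a ℕ.* b))              ≈⟨ toℚᵘ-ℕtoℚ (a ℕ.* b) ⟩
    mkℚᵘ (+ (a ℕ.* b)) 0               ≈⟨ *≡* (cong (ℤ._* + 1) (ℤₚ.pos-* a b)) ⟩
    mkℚᵘ (+ a) 0 ℚᵘ.* mkℚᵘ (+ b) 0     ≈⟨ ℚᵘₚ.*-cong (toℚᵘ-ℕtoℚ a) (toℚᵘ-ℕtoℚ b) ⟨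
    toℚᵘ (ℕtoℚ a) ℚᵘ.* toℚᵘ (ℕtoℚ b)   ≈⟨ ℚₚ.toℚᵘ-homo-* (ℕtoℚ a) (ℕtoℚ b) ⟨
    toℚᵘ (ℕtoℚ a * ℕtoℚ b)             ∎)
    where open ℚᵘₚ.≃-Reasoning

  frac-*-ℕtoℚ : ∀ a l → frac a (suc l) * ℕtoℚ (suc l) ≡ ℕtoℚ a
  frac-*-ℕtoℚ a l = ℚₚ.toℚᵘ-injective (begin
    toℚᵘ (frac a (suc l) * ℕtoℚ (suc l))                 ≈⟨ ℚₚ.toℚᵘ-homo-* (frac a (suc l)) (ℕtoℚ (suc l)) ⟩
    toℚᵘ (frac a (suc l)) ℚᵘ.* toℚᵘ (ℕtoℚ (suc l))       ≈⟨ ℚᵘₚ.*-cong (ℚₚ.toℚᵘ-fromℚᵘ (mkℚᵘ (+ a) l)) (toℚᵘ-ℕtoℚ (suc l)) ⟩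
    mkℚᵘ (+ a) l ℚᵘ.* mkℚᵘ (+ suc l) 0                   ≈⟨ *≡* eq ⟩
    mkℚᵘ (+ a) 0                                          ≈⟨ toℚᵘ-ℕtoℚ a ⟨
    toℚᵘ (ℕtoℚ a)                                         ∎)
    where
    open ℚᵘₚ.≃-Reasoning
    eq : + a ℤ.* + suc l ℤ.* + 1 ≡ + a ℤ.* + (suc l ℕ.* 1)
    eq rewrite ℕₚ.*-identityʳ (suc l) = ℤₚ.*-identityʳ _

  ℕtoℚ-suc-cancelˡ : ∀ l {p q} → ℕtoℚ (suc l) * p ≡ ℕtoℚ (suc l) * q → p ≡ q
  ℕtoℚ-suc-cancelˡ l {p} {q} eq = begin
    p                ≡⟨ ℚₚ.*-identityˡ p ⟨
    1ℚ * p           ≡⟨ cong (_* p) (ℚₚ.*-inverseˡ r) ⟨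
    (1/ r) * r * p   ≡⟨ ℚₚ.*-assoc (1/ r) r p ⟩
    1/ r * (r * p)   ≡⟨ cong (1/ r *_) (subst (λ z → z * p ≡ z * q) (ℕtoℚ≡mkℚ (suc l)) eq) ⟩
    1/ r * (r * q)   ≡⟨ ℚₚ.*-assoc (1/ r) r q ⟨
    (1/ r) * r * q   ≡⟨ cong (_* q) (ℚₚ.*-inverseˡ r) ⟩
    1ℚ * q           ≡⟨ ℚₚ.*-identityˡ q ⟩
    q                ∎
    where
    open ≡-Reasoning
    r : ℚ
    r = mkℚ (+ suc l) 0 (Coprime.sym (Coprime.1-coprimeTo (suc l)))

-- Finite sums

∑ : ℕ → (ℕ → ℚ) → ℚ
∑ zero    f = 0ℚ
∑ (suc n) f = f 0 + ∑ n (f ∘ suc)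

∑-cong< : ∀ n {f g : ℕ → ℚ} → (∀ i → i < n → f i ≡ g i) → ∑ n f ≡ ∑ n g
∑-cong< zero    eq = refl
∑-cong< (suc n) eq = cong₂ _+_ (eq 0 (s≤s z≤n)) (∑-cong< n (λ i i<n → eq (suc i) (s≤s i<n)))

∑-cong : ∀ n {f g : ℕ → ℚ} → (∀ i → f i ≡ g i) → ∑ n f ≡ ∑ n g
∑-cong n eq = ∑-cong< n (λ i _ → eq i)

∑-zero< : ∀ n {f : ℕ → ℚ} → (∀ i → i < n → f i ≡ 0ℚ) → ∑ n f ≡ 0ℚ
∑-zero< zero    eq = refl
∑-zero< (suc n) eq = trans (cong₂ _+_ (eq 0 (s≤s z≤n)) (∑-zero< n (λ i i<n → eq (suc i) (s≤s i<n))))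
                           (ℚₚ.+-identityˡ 0ℚ)

∑-zero : ∀ n {f : ℕ → ℚ} → (∀ i → f i ≡ 0ℚ) → ∑ n f ≡ 0ℚ
∑-zero n eq = ∑-zero< n (λ i _ → eq i)

∑-+ : ∀ n (f g : ℕ → ℚ) → ∑ n (λ i → f i + g i) ≡ ∑ n f + ∑ n g
∑-+ zero    f g = sym (ℚₚ.+-identityˡ 0ℚ)
∑-+ (suc n) f g = trans (cong (f 0 + g 0 +_) (∑-+ n (f ∘ suc) (g ∘ suc))) (+-interchange (f 0) (g 0) _ _)

∑-*ˡ : ∀ n c (f : ℕ → ℚ) → c * ∑ n f ≡ ∑ n (λ i → c * f i)
∑-*ˡ zero    c f = ℚₚ.*-zeroʳ c
∑-*ˡ (suc n) c f = trans (ℚₚ.*-distribˡ-+ c (f 0) _) (cong (c * f 0 +_) (∑-*ˡ n c (f ∘ suc)))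

∑-*ʳ : ∀ n c (f : ℕ → ℚ) → ∑ n f * c ≡ ∑ n (λ i → f i * c)
∑-*ʳ n c f = trans (ℚₚ.*-comm (∑ n f) c) (trans (∑-*ˡ n c f) (∑-cong n (λ i → ℚₚ.*-comm c (f i))))

∑-last : ∀ n (f : ℕ → ℚ) → ∑ (suc n) f ≡ ∑ n f + f n
∑-last zero    f = trans (ℚₚ.+-identityʳ (f 0)) (sym (ℚₚ.+-identityˡ (f 0)))
∑-last (suc n) f = trans (cong (f 0 +_) (∑-last n (f ∘ suc))) (sym (ℚₚ.+-assoc (f 0) _ _))

∑-++ : ∀ m n (f : ℕ → ℚ) → ∑ (m ℕ.+ n) f ≡ ∑ m f + ∑ n (λ i → f (m ℕ.+ i))
∑-++ zero    n f = sym (ℚₚ.+-identityˡ _)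
∑-++ (suc m) n f = trans (cong (f 0 +_) (∑-++ m n (f ∘ suc))) (sym (ℚₚ.+-assoc (f 0) _ _))

∑-reverse : ∀ e (f : ℕ → ℚ) → ∑ (suc e) f ≡ ∑ (suc e) (λ a → f (e ∸ a))
∑-reverse zero    f = refl
∑-reverse (suc e) f = begin
  f 0 + ∑ (suc e) (f ∘ suc)                          ≡⟨ cong (f 0 +_) (∑-reverse e (f ∘ suc)) ⟩
  f 0 + ∑ (suc e) (λ a → f (suc (e ∸ a)))            ≡⟨ ℚₚ.+-comm (f 0) _ ⟩
  ∑ (suc e) (λ a → f (suc (e ∸ a))) + f 0            ≡⟨ cong₂ _+_ (∑-cong< (suc e) (λ a a≤e →
                                                          cong f (sym (ℕₚ.+-∸-assoc 1 (ℕₚ.≤-pred a≤e)))))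
                                                         (cong f (sym (ℕₚ.n∸n≡0 (suc e)))) ⟩
  ∑ (suc e) (λ a → f (suc e ∸ a)) + f (suc e ∸ suc e) ≡⟨ ∑-last (suc e) (λ a → f (suc e ∸ a)) ⟨
  ∑ (suc (suc e)) (λ a → f (suc e ∸ a))              ∎
  where open ≡-Reasoning

∑-single : ∀ n c (f : ℕ → ℚ) → c < n → (∀ i → i < n → i ≢ c → f i ≡ 0ℚ) → ∑ n f ≡ f c
∑-single (suc n) zero    f _ others = trans (cong (f 0 +_) (∑-zero< n (λ i i<n → others (suc i) (s≤s i<n) (λ ()))))
                                            (ℚₚ.+-identityʳ (f 0))
∑-single (suc n) (suc c) f (s≤s c<n) others =
  trans (cong (_+ ∑ n (f ∘ suc)) (others 0 (s≤s z≤n) (λ ())))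
        (trans (ℚₚ.+-identityˡ _)
               (∑-single n c (f ∘ suc) c<n (λ i i<n i≢c → others (suc i) (s≤s i<n) (i≢c ∘ ℕₚ.suc-injective))))

∑-triangle : ∀ e (T : ℕ → ℕ → ℕ → ℚ) →
  ∑ (suc e) (λ a → ∑ (suc a) (λ b → T b (a ∸ b) (e ∸ a)))
    ≡ ∑ (suc e) (λ b → ∑ (suc (e ∸ b)) (λ c → T b c (e ∸ b ∸ c)))
∑-triangle zero    T = refl
∑-triangle (suc e) T = begin
  ∑ (suc (suc e)) (λ a → T 0 a (suc e ∸ a) + ∑ a (λ b → T (suc b) (a ∸ suc b) (suc e ∸ a)))
    ≡⟨ ∑-+ (suc (suc e)) (λ a → T 0 a (suc e ∸ a)) (λ a → ∑ a (λ b → T (suc b) (a ∸ suc b) (suc e ∸ a))) ⟩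
  ∑ (suc (suc e)) (λ a → T 0 a (suc e ∸ a)) + (0ℚ + ∑ (suc e) (λ a → ∑ (suc a) (λ b → T (suc b) (a ∸ b) (e ∸ a))))
    ≡⟨ cong (∑ (suc (suc e)) (λ a → T 0 a (suc e ∸ a)) +_)
            (trans (ℚₚ.+-identityˡ _) (∑-triangle e (T ∘ suc))) ⟩
  ∑ (suc (suc e)) (λ a → T 0 a (suc e ∸ a)) + ∑ (suc e) (λ b → ∑ (suc (e ∸ b)) (λ c → T (suc b) c (e ∸ b ∸ c)))
    ∎
  where open ≡-Reasoning

sumℚ-++ : ∀ xs ys → sumℚ (xs ++ ys) ≡ sumℚ xs + sumℚ ys
sumℚ-++ []       ys = sym (ℚₚ.+-identityˡ _)
sumℚ-++ (x ∷ xs) ys = trans (cong (x +_) (sumℚ-++ xs ys)) (sym (ℚₚ.+-assoc x _ _))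

sumℚ-map-map : ∀ {A B : Set} (h : B → ℚ) (g : A → B) xs → sumℚ (map h (map g xs)) ≡ sumℚ (map (h ∘ g) xs)
sumℚ-map-map h g xs = cong sumℚ (sym (Listₚ.map-∘ xs))

sumℚ-map-concatMap : ∀ {A B : Set} (h : B → ℚ) (g : A → List B) xs →
  sumℚ (map h (concatMap g xs)) ≡ sumℚ (map (λ x → sumℚ (map h (g x))) xs)
sumℚ-map-concatMap h g []       = refl
sumℚ-map-concatMap h g (x ∷ xs) = begin
  sumℚ (map h (g x ++ concatMap g xs))                 ≡⟨ cong sumℚ (Listₚ.map-++ h (g x) _) ⟩
  sumℚ (map h (g x) ++ map h (concatMap g xs))         ≡⟨ sumℚ-++ (map h (g x)) _ ⟩
  sumℚ (map h (g x)) + sumℚ (map h (concatMap g xs))   ≡⟨ cong (sumℚ (map h (g x)) +_) (sumℚ-map-concatMap h g xs) ⟩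
  sumℚ (map h (g x)) + sumℚ (map (λ x → sumℚ (map h (g x))) xs) ∎
  where open ≡-Reasoning

sumℚ-upTo : ∀ (f : ℕ → ℚ) n → sumℚ (map f (upTo n)) ≡ ∑ n f
sumℚ-upTo f n = go id n
  where
  go : ∀ (g : ℕ → ℕ) n → sumℚ (map f (applyUpTo g n)) ≡ ∑ n (f ∘ g)
  go g zero    = refl
  go g (suc n) = cong (f (g 0) +_) (go (g ∘ suc) n)

sumℚ-cong : ∀ {A : Set} {f g : A → ℚ} xs → (∀ x → f x ≡ g x) → sumℚ (map f xs) ≡ sumℚ (map g xs)
sumℚ-cong []       eq = refl
sumℚ-cong (x ∷ xs) eq = cong₂ _+_ (eq x) (sumℚ-cong xs eq)

sumℚ-congAll : ∀ {A : Set} {f g : A → ℚ} {xs} → All (λ x → f x ≡ g x) xs → sumℚ (map f xs) ≡ sumℚ (map g xs)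
sumℚ-congAll []         = refl
sumℚ-congAll (eq ∷ eqs) = cong₂ _+_ eq (sumℚ-congAll eqs)

sumℚ-zero : ∀ {A : Set} {f : A → ℚ} xs → (∀ x → f x ≡ 0ℚ) → sumℚ (map f xs) ≡ 0ℚ
sumℚ-zero []       eq = refl
sumℚ-zero (x ∷ xs) eq = trans (cong₂ _+_ (eq x) (sumℚ-zero xs eq)) (ℚₚ.+-identityˡ 0ℚ)

sumℚ-+ : ∀ {A : Set} (f g : A → ℚ) xs → sumℚ (map (λ x → f x + g x) xs) ≡ sumℚ (map f xs) + sumℚ (map g xs)
sumℚ-+ f g []       = sym (ℚₚ.+-identityˡ 0ℚ)
sumℚ-+ f g (x ∷ xs) = trans (cong (f x + g x +_) (sumℚ-+ f g xs)) (+-interchange (f x) (g x) _ _)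

sumℚ-*ˡ : ∀ {A : Set} c (f : A → ℚ) xs → c * sumℚ (map f xs) ≡ sumℚ (map (λ x → c * f x) xs)
sumℚ-*ˡ c f []       = ℚₚ.*-zeroʳ c
sumℚ-*ˡ c f (x ∷ xs) = trans (ℚₚ.*-distribˡ-+ c (f x) _) (cong (c * f x +_) (sumℚ-*ˡ c f xs))

sumℚ-∑ : ∀ {A : Set} n (f : ℕ → A → ℚ) xs → sumℚ (map (λ x → ∑ n (λ i → f i x)) xs) ≡ ∑ n (λ i → sumℚ (map (f i) xs))
sumℚ-∑ n f []       = sym (∑-zero n (λ _ → refl))
sumℚ-∑ n f (x ∷ xs) = trans (cong (∑ n (λ i → f i x) +_) (sumℚ-∑ n f xs))
                            (sym (∑-+ n (λ i → f i x) (λ i → sumℚ (map (f i) xs))))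

sumℚ-swap : ∀ {A B : Set} (k : A → B → ℚ) xs ys →
  sumℚ (map (λ x → sumℚ (map (k x) ys)) xs) ≡ sumℚ (map (λ y → sumℚ (map (λ x → k x y) xs)) ys)
sumℚ-swap k []       ys = sym (sumℚ-zero ys (λ _ → refl))
sumℚ-swap k (x ∷ xs) ys = trans (cong (sumℚ (map (k x) ys) +_) (sumℚ-swap k xs ys))
                                (sym (sumℚ-+ (k x) (λ y → sumℚ (map (λ x → k x y) xs)) ys))

-- The semiring of series

curryS : Series → Entry → Series
curryS F x ν = F (x ∷ ν)

∑S : ℕ → (ℕ → Series) → Series
∑S n f μ = ∑ n (λ k → f k μ)

⊗-∷ : ∀ F G i j e μ →
  (F ⊗ G) ((i , j , e) ∷ μ) ≡ ∑ (suc e) (λ a → (curryS F (i , j , a) ⊗ curryS G (i , j , e ∸ a)) μ)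
⊗-∷ F G i j e μ = begin
  sumℚ (map term (concatMap (λ a → map (extend a) (splits μ)) (upTo (suc e))))
    ≡⟨ sumℚ-map-concatMap term (λ a → map (extend a) (splits μ)) (upTo (suc e)) ⟩
  sumℚ (map (λ a → sumℚ (map term (map (extend a) (splits μ)))) (upTo (suc e)))
    ≡⟨ sumℚ-cong (upTo (suc e)) (λ a → sumℚ-map-map term (extend a) (splits μ)) ⟩
  sumℚ (map (λ a → (curryS F (i , j , a) ⊗ curryS G (i , j , e ∸ a)) μ) (upTo (suc e)))
    ≡⟨ sumℚ-upTo (λ a → (curryS F (i , j , a) ⊗ curryS G (i , j , e ∸ a)) μ) (suc e) ⟩
  ∑ (suc e) (λ a → (curryS F (i , j , a) ⊗ curryS G (i , j , e ∸ a)) μ) ∎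
  where
  open ≡-Reasoning
  term : Mono × Mono → ℚ
  term (ν , ρ) = F ν * G ρ
  extend : ℕ → Mono × Mono → Mono × Mono
  extend a (ν , ρ) = ((i , j , a) ∷ ν , (i , j , e ∸ a) ∷ ρ)

⊗-[] : ∀ F G → (F ⊗ G) [] ≡ F [] * G []
⊗-[] F G = ℚₚ.+-identityʳ _

⊗-congˡ : ∀ {F F'} G → F ≗ F' → (F ⊗ G) ≗ (F' ⊗ G)
⊗-congˡ G F≗F' μ = sumℚ-cong (splits μ) (λ (ν , ρ) → cong (_* G ρ) (F≗F' ν))

⊗-congʳ : ∀ F {G G'} → G ≗ G' → (F ⊗ G) ≗ (F ⊗ G')
⊗-congʳ F G≗G' μ = sumℚ-cong (splits μ) (λ (ν , ρ) → cong (F ν *_) (G≗G' ρ))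

⊗-comm : ∀ F G → (F ⊗ G) ≗ (G ⊗ F)
⊗-comm F G [] = trans (⊗-[] F G) (trans (ℚₚ.*-comm (F []) (G [])) (sym (⊗-[] G F)))
⊗-comm F G ((i , j , e) ∷ μ) = begin
  (F ⊗ G) ((i , j , e) ∷ μ)                                       ≡⟨ ⊗-∷ F G i j e μ ⟩
  ∑ (suc e) (λ a → (F′ a ⊗ G′ (e ∸ a)) μ)                         ≡⟨ ∑-cong (suc e) (λ a → ⊗-comm (F′ a) (G′ (e ∸ a)) μ) ⟩
  ∑ (suc e) (λ a → (G′ (e ∸ a) ⊗ F′ a) μ)                         ≡⟨ ∑-reverse e (λ a → (G′ (e ∸ a) ⊗ F′ a) μ) ⟩
  ∑ (suc e) (λ a → (G′ (e ∸ (e ∸ a)) ⊗ F′ (e ∸ a)) μ)             ≡⟨ ∑-cong< (suc e) (λ a a≤e →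
                                                                       cong (λ b → (G′ b ⊗ F′ (e ∸ a)) μ) (ℕₚ.m∸[m∸n]≡n (ℕₚ.≤-pred a≤e))) ⟩
  ∑ (suc e) (λ a → (G′ a ⊗ F′ (e ∸ a)) μ)                         ≡⟨ ⊗-∷ G F i j e μ ⟨
  (G ⊗ F) ((i , j , e) ∷ μ)                                       ∎
  where
  open ≡-Reasoning
  F′ G′ : ℕ → Series
  F′ a = curryS F (i , j , a)
  G′ a = curryS G (i , j , a)

⊗-zeroˡ : ∀ G → (zeroS ⊗ G) ≗ zeroS
⊗-zeroˡ G μ = sumℚ-zero (splits μ) (λ (ν , ρ) → ℚₚ.*-zeroˡ (G ρ))

⊗-distribʳ : ∀ G F F' → ((F ⊕ F') ⊗ G) ≗ ((F ⊗ G) ⊕ (F' ⊗ G))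
⊗-distribʳ G F F' μ =
  trans (sumℚ-cong (splits μ) (λ (ν , ρ) → ℚₚ.*-distribʳ-+ (G ρ) (F ν) (F' ν)))
        (sumℚ-+ (λ (ν , ρ) → F ν * G ρ) (λ (ν , ρ) → F' ν * G ρ) (splits μ))

⊗-identityˡ : ∀ F → (oneS ⊗ F) ≗ F
⊗-identityˡ F [] = trans (⊗-[] oneS F) (ℚₚ.*-identityˡ (F []))
⊗-identityˡ F ((i , j , e) ∷ μ) = begin
  (oneS ⊗ F) ((i , j , e) ∷ μ)                      ≡⟨ ⊗-∷ oneS F i j e μ ⟩
  (oneS ⊗ curryS F (i , j , e)) μ + ∑ e (λ a → (curryS oneS (i , j , suc a) ⊗ curryS F (i , j , e ∸ suc a)) μ)
    ≡⟨ cong₂ _+_ (⊗-identityˡ (curryS F (i , j , e)) μ)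
                 (∑-zero e (λ a → ⊗-zeroˡ (curryS F (i , j , e ∸ suc a)) μ)) ⟩
  F ((i , j , e) ∷ μ) + 0ℚ                          ≡⟨ ℚₚ.+-identityʳ _ ⟩
  F ((i , j , e) ∷ μ)                               ∎
  where open ≡-Reasoning

⊗-·ˡ : ∀ c F G → ((c · F) ⊗ G) ≗ (c · (F ⊗ G))
⊗-·ˡ c F G μ = trans (sumℚ-cong (splits μ) (λ (ν , ρ) → ℚₚ.*-assoc c (F ν) (G ρ)))
                     (sym (sumℚ-*ˡ c (λ (ν , ρ) → F ν * G ρ) (splits μ)))

⊗-∑Sˡ : ∀ n f G → (∑S n f ⊗ G) ≗ ∑S n (λ k → f k ⊗ G)
⊗-∑Sˡ n f G μ = trans (sumℚ-cong (splits μ) (λ (ν , ρ) → ∑-*ʳ n (G ρ) (λ k → f k ν)))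
                      (sumℚ-∑ n (λ k (ν , ρ) → f k ν * G ρ) (splits μ))

⊗-∑Sʳ : ∀ F n g → (F ⊗ ∑S n g) ≗ ∑S n (λ k → F ⊗ g k)
⊗-∑Sʳ F n g μ = trans (⊗-comm F (∑S n g) μ) (trans (⊗-∑Sˡ n g F μ) (∑-cong n (λ k → ⊗-comm (g k) F μ)))

⊗-assoc : ∀ F G K → ((F ⊗ G) ⊗ K) ≗ (F ⊗ (G ⊗ K))
⊗-assoc F G K [] = begin
  ((F ⊗ G) ⊗ K) []         ≡⟨ trans (⊗-[] (F ⊗ G) K) (cong (_* K []) (⊗-[] F G)) ⟩
  F [] * G [] * K []       ≡⟨ ℚₚ.*-assoc (F []) (G []) (K []) ⟩
  F [] * (G [] * K [])     ≡⟨ trans (⊗-[] F (G ⊗ K)) (cong (F [] *_) (⊗-[] G K)) ⟨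
  (F ⊗ (G ⊗ K)) []         ∎
  where open ≡-Reasoning
⊗-assoc F G K ((i , j , e) ∷ μ) = begin
  ((F ⊗ G) ⊗ K) ((i , j , e) ∷ μ)
    ≡⟨ ⊗-∷ (F ⊗ G) K i j e μ ⟩
  ∑ (suc e) (λ a → (curryS (F ⊗ G) (i , j , a) ⊗ K′ (e ∸ a)) μ)
    ≡⟨ ∑-cong (suc e) (λ a → ⊗-congˡ (K′ (e ∸ a)) (⊗-∷ F G i j a) μ) ⟩
  ∑ (suc e) (λ a → (∑S (suc a) (λ b → F′ b ⊗ G′ (a ∸ b)) ⊗ K′ (e ∸ a)) μ)
    ≡⟨ ∑-cong (suc e) (λ a → ⊗-∑Sˡ (suc a) (λ b → F′ b ⊗ G′ (a ∸ b)) (K′ (e ∸ a)) μ) ⟩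
  ∑ (suc e) (λ a → ∑ (suc a) (λ b → ((F′ b ⊗ G′ (a ∸ b)) ⊗ K′ (e ∸ a)) μ))
    ≡⟨ ∑-cong (suc e) (λ a → ∑-cong (suc a) (λ b → ⊗-assoc (F′ b) (G′ (a ∸ b)) (K′ (e ∸ a)) μ)) ⟩
  ∑ (suc e) (λ a → ∑ (suc a) (λ b → T b (a ∸ b) (e ∸ a)))
    ≡⟨ ∑-triangle e T ⟩
  ∑ (suc e) (λ b → ∑ (suc (e ∸ b)) (λ c → T b c (e ∸ b ∸ c)))
    ≡⟨ ∑-cong (suc e) (λ b → ⊗-∑Sʳ (F′ b) (suc (e ∸ b)) (λ c → G′ c ⊗ K′ (e ∸ b ∸ c)) μ) ⟨
  ∑ (suc e) (λ b → (F′ b ⊗ ∑S (suc (e ∸ b)) (λ c → G′ c ⊗ K′ (e ∸ b ∸ c))) μ)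
    ≡⟨ ∑-cong (suc e) (λ b → ⊗-congʳ (F′ b) (⊗-∷ G K i j (e ∸ b)) μ) ⟨
  ∑ (suc e) (λ b → (F′ b ⊗ curryS (G ⊗ K) (i , j , e ∸ b)) μ)
    ≡⟨ ⊗-∷ F (G ⊗ K) i j e μ ⟨
  (F ⊗ (G ⊗ K)) ((i , j , e) ∷ μ) ∎
  where
  open ≡-Reasoning
  F′ G′ K′ : ℕ → Series
  F′ a = curryS F (i , j , a)
  G′ a = curryS G (i , j , a)
  K′ a = curryS K (i , j , a)
  T : ℕ → ℕ → ℕ → ℚ
  T b c d = (F′ b ⊗ (G′ c ⊗ K′ d)) μ

Series-commutativeSemiring : CommutativeSemiring _ _
Series-commutativeSemiring = record
  { isCommutativeSemiring = IsCommutativeSemiringˡ.isCommutativeSemiring (record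
    { +-isCommutativeMonoid = Pointwise.isCommutativeMonoid Mono ℚₚ.+-0-isCommutativeMonoid
    ; *-isCommutativeMonoid = record
      { isMonoid = record
        { isSemigroup = record
          { isMagma = record
            { isEquivalence = Pointwise.isEquivalence Mono isEquivalence
            ; ∙-cong = λ {F} {F'} F≗F' G≗G' μ → trans (⊗-congˡ _ F≗F' μ) (⊗-congʳ F' G≗G' μ) }
          ; assoc = ⊗-assoc }
        ; identity = ⊗-identityˡ , (λ F μ → trans (⊗-comm F oneS μ) (⊗-identityˡ F μ)) }
      ; comm = ⊗-comm }
    ; distribʳ = ⊗-distribʳ
    ; zeroˡ = ⊗-zeroˡ }) }

open CommutativeSemiring Series-commutativeSemiring
  using () renaming (*-identityʳ to ⊗-identityʳ; distribˡ to ⊗-distribˡ; zeroʳ to ⊗-zeroʳ)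
open import Algebra.Properties.Semiring.Exp (CommutativeSemiring.semiring Series-commutativeSemiring)
  using (_^_)
import Algebra.Properties.Semiring.Mult (CommutativeSemiring.semiring Series-commutativeSemiring) as Mult
import Algebra.Properties.Monoid.Sum (CommutativeSemiring.+-monoid Series-commutativeSemiring) as Sum
import Algebra.Properties.CommutativeSemiring.Binomial Series-commutativeSemiring as Binomial

⊗-·ʳ : ∀ c F G → (F ⊗ (c · G)) ≗ (c · (F ⊗ G))
⊗-·ʳ c F G μ = trans (⊗-comm F (c · G) μ) (trans (⊗-·ˡ c G F μ) (cong (c *_) (⊗-comm G F μ)))

^-cong : ∀ {X Y} n → X ≗ Y → (X ^ n) ≗ (Y ^ n)
^-cong zero    X≗Y μ = refl
^-cong {X} {Y} (suc n) X≗Y μ = trans (⊗-congˡ (X ^ n) X≗Y μ) (⊗-congʳ Y (^-cong n X≗Y) μ)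

binomial : ∀ ℓ X Y → ((X ⊕ Y) ^ ℓ) ≗ ∑S (suc ℓ) (λ a → ℕtoℚ (ℓ C a) · ((X ^ a) ⊗ (Y ^ (ℓ ∸ a))))
binomial ℓ X Y μ = trans (Binomial.theorem ℓ X Y μ)
  (trans (sum-at (suc ℓ) (λ a → (ℓ C a) Mult.× ((X ^ a) ⊗ (Y ^ (ℓ ∸ a)))))
         (∑-cong (suc ℓ) (λ a → ×-at (ℓ C a) ((X ^ a) ⊗ (Y ^ (ℓ ∸ a))))))
  where
  ×-at : ∀ m F → (m Mult.× F) μ ≡ ℕtoℚ m * F μ
  ×-at zero    F = sym (ℚₚ.*-zeroˡ (F μ))
  ×-at (suc m) F = begin
    F μ + (m Mult.× F) μ        ≡⟨ cong₂ _+_ (sym (ℚₚ.*-identityˡ (F μ))) (×-at m F) ⟩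
    1ℚ * F μ + ℕtoℚ m * F μ     ≡⟨ ℚₚ.*-distribʳ-+ (F μ) 1ℚ (ℕtoℚ m) ⟨
    (1ℚ + ℕtoℚ m) * F μ         ≡⟨ cong (_* F μ) (ℕtoℚ-+ 1 m) ⟨
    ℕtoℚ (suc m) * F μ          ∎
    where open ≡-Reasoning
  sum-at : ∀ n (f : ℕ → Series) → Sum.sum {n} (f ∘ toℕ) μ ≡ ∑ n (λ k → f k μ)
  sum-at zero    f = refl
  sum-at (suc n) f = cong (f 0 μ +_) (sum-at n (f ∘ suc))

-- Degree, homogeneity and the Euler derivation

Valid : Mono → Set
Valid = All (λ (i , j , e) → 1 ≤ i)

degree : Mono → ℕ
degree []              = 0
degree ((i , j , e) ∷ μ) = i ℕ.* e ℕ.+ degree μ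

exponentSum : Mono → ℕ
exponentSum []              = 0
exponentSum ((i , j , e) ∷ μ) = e ℕ.+ exponentSum μ

exponentSum≤degree : ∀ μ → Valid μ → exponentSum μ ≤ degree μ
exponentSum≤degree []              []       = z≤n
exponentSum≤degree ((i , j , e) ∷ μ) (1≤i ∷ v) =
  ℕₚ.+-mono-≤ (subst (_≤ i ℕ.* e) (ℕₚ.*-identityˡ e) (ℕₚ.*-monoˡ-≤ e 1≤i)) (exponentSum≤degree μ v)

record IsSplitOf (μ : Mono) (νρ : Mono × Mono) : Set where
  field
    degree-+      : degree (proj₁ νρ) ℕ.+ degree (proj₂ νρ) ≡ degree μ
    exponentSum-+ : exponentSum (proj₁ νρ) ℕ.+ exponentSum (proj₂ νρ) ≡ exponentSum μ
    valid         : Valid μ → Valid (proj₁ νρ) × Valid (proj₂ νρ)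

splits-sound : ∀ μ → All (IsSplitOf μ) (splits μ)
splits-sound [] = record { degree-+ = refl ; exponentSum-+ = refl ; valid = λ _ → [] , [] } ∷ []
splits-sound ((i , j , e) ∷ μ) =
  Allₚ.concat⁺ (Allₚ.map⁺ (Allₚ.applyUpTo⁺₁ id (suc e) (λ a<1+e →
    Allₚ.map⁺ (All.map (extend (ℕₚ.≤-pred a<1+e)) (splits-sound μ)))))
  where
  split-+ : ∀ p q x y {r z} → p ℕ.+ q ≡ r → x ℕ.+ y ≡ z → (p ℕ.+ x) ℕ.+ (q ℕ.+ y) ≡ r ℕ.+ z
  split-+ p q x y p+q≡r x+y≡z = trans (ℕ-+-interchange p x q y) (cong₂ ℕ._+_ p+q≡r x+y≡z)
  extend : ∀ {a} → a ≤ e → ∀ {νρ} → IsSplitOf μ νρ →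
           IsSplitOf ((i , j , e) ∷ μ) ((i , j , a) ∷ proj₁ νρ , (i , j , e ∸ a) ∷ proj₂ νρ)
  extend {a} a≤e {ν , ρ} s = record
    { degree-+      = split-+ (i ℕ.* a) (i ℕ.* (e ∸ a)) (degree ν) (degree ρ)
                              (trans (sym (ℕₚ.*-distribˡ-+ i a (e ∸ a))) (cong (i ℕ.*_) (ℕₚ.m+[n∸m]≡n a≤e)))
                              (IsSplitOf.degree-+ s)
    ; exponentSum-+ = split-+ a (e ∸ a) (exponentSum ν) (exponentSum ρ) (ℕₚ.m+[n∸m]≡n a≤e) (IsSplitOf.exponentSum-+ s)
    ; valid         = λ { (1≤i ∷ v) → (1≤i ∷ proj₁ (IsSplitOf.valid s v)) , (1≤i ∷ proj₂ (IsSplitOf.valid s v)) }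
    }

⊗-congOnSplits : ∀ F G F' G' μ → (∀ ν ρ → IsSplitOf μ (ν , ρ) → F ν * G ρ ≡ F' ν * G' ρ) → (F ⊗ G) μ ≡ (F' ⊗ G') μ
⊗-congOnSplits F G F' G' μ eq = sumℚ-congAll (All.map (λ {(ν , ρ)} → eq ν ρ) (splits-sound μ))

⊗-zeroOnSplits : ∀ F G μ → (∀ ν ρ → IsSplitOf μ (ν , ρ) → F ν * G ρ ≡ 0ℚ) → (F ⊗ G) μ ≡ 0ℚ
⊗-zeroOnSplits F G μ eq = trans (⊗-congOnSplits F G zeroS zeroS μ (λ ν ρ s → trans (eq ν ρ s) (sym (ℚₚ.*-zeroˡ 0ℚ))))
                                (⊗-zeroˡ zeroS μ)

Homogeneous : ℕ → Series → Set
Homogeneous n F = ∀ μ → degree μ ≢ n → F μ ≡ 0ℚ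

⊗-homogeneous : ∀ {a b F G} → Homogeneous a F → Homogeneous b G → Homogeneous (a ℕ.+ b) (F ⊗ G)
⊗-homogeneous {a} {b} {F} {G} homF homG μ deg≢ = ⊗-zeroOnSplits F G μ vanish
  where
  vanish : ∀ ν ρ → IsSplitOf μ (ν , ρ) → F ν * G ρ ≡ 0ℚ
  vanish ν ρ s with degree ν ℕ.≟ a | degree ρ ℕ.≟ b
  ... | no ν≢ | _      = trans (cong (_* G ρ) (homF ν ν≢)) (ℚₚ.*-zeroˡ (G ρ))
  ... | yes _ | no ρ≢  = trans (cong (F ν *_) (homG ρ ρ≢)) (ℚₚ.*-zeroʳ (F ν))
  ... | yes ν≡ | yes ρ≡ = ⊥-elim (deg≢ (trans (sym (IsSplitOf.degree-+ s)) (cong₂ ℕ._+_ ν≡ ρ≡)))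

oneS-homogeneous : Homogeneous 0 oneS
oneS-homogeneous []                    deg≢ = ⊥-elim (deg≢ refl)
oneS-homogeneous ((i , j , zero) ∷ μ)  deg≢ = oneS-homogeneous μ (deg≢ ∘ trans (cong (ℕ._+ degree μ) (ℕₚ.*-zeroʳ i)))
oneS-homogeneous ((i , j , suc e) ∷ μ) deg≢ = refl

^-homogeneous : ∀ {m X} → Homogeneous m X → ∀ a → Homogeneous (a ℕ.* m) (X ^ a)
^-homogeneous homX zero    = oneS-homogeneous
^-homogeneous homX (suc a) = ⊗-homogeneous homX (^-homogeneous homX a)

⊗-homogeneous-below : ∀ {m X} Y μ → Homogeneous m X → degree μ < m → (X ⊗ Y) μ ≡ 0ℚ
⊗-homogeneous-below {m} {X} Y μ homX deg<m = ⊗-zeroOnSplits X Y μ (λ ν ρ s →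
  trans (cong (_* Y ρ) (homX ν (λ ν≡m → ℕₚ.<⇒≱ deg<m
           (subst (_≤ degree μ) ν≡m (subst (degree ν ≤_) (IsSplitOf.degree-+ s) (ℕₚ.m≤m+n (degree ν) (degree ρ)))))))
        (ℚₚ.*-zeroˡ (Y ρ)))

VanishesBelow : ℕ → Series → Set
VanishesBelow n F = ∀ μ → exponentSum μ < n → F μ ≡ 0ℚ

⊗-vanishesBelow : ∀ {a b F G} → VanishesBelow a F → VanishesBelow b G → VanishesBelow (a ℕ.+ b) (F ⊗ G)
⊗-vanishesBelow {a} {b} {F} {G} vanF vanG μ μ< = ⊗-zeroOnSplits F G μ vanish
  where
  vanish : ∀ ν ρ → IsSplitOf μ (ν , ρ) → F ν * G ρ ≡ 0ℚ
  vanish ν ρ s with exponentSum ν ℕ.<? a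
  ... | yes ν< = trans (cong (_* G ρ) (vanF ν ν<)) (ℚₚ.*-zeroˡ (G ρ))
  ... | no ν≮ = trans (cong (F ν *_) (vanG ρ (ℕₚ.+-cancelˡ-< a (exponentSum ρ) b
                  (ℕₚ.≤-<-trans (ℕₚ.+-monoˡ-≤ (exponentSum ρ) (ℕₚ.≮⇒≥ ν≮))
                                 (subst (ℕ._< a ℕ.+ b) (sym (IsSplitOf.exponentSum-+ s)) μ<)))))
                  (ℚₚ.*-zeroʳ (F ν))

infix 4 _≈[≤_]_ _≈[_]_

_≈[≤_]_ : Series → ℕ → Series → Set
F ≈[≤ n ] G = ∀ μ → Valid μ → degree μ ≤ n → F μ ≡ G μ

_≈[_]_ : Series → ℕ → Series → Set
F ≈[ n ] G = ∀ μ → Valid μ → degree μ ≡ n → F μ ≡ G μ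

⊗-cong-≈[≤] : ∀ {n F F' G G'} → F ≈[≤ n ] F' → G ≈[≤ n ] G' → (F ⊗ G) ≈[≤ n ] (F' ⊗ G')
⊗-cong-≈[≤] {n} {F} {F'} {G} {G'} F≈F' G≈G' μ v deg≤ = ⊗-congOnSplits F G F' G' μ (λ ν ρ s →
  let open IsSplitOf s
      deg≤' = subst (_≤ n) (sym degree-+) deg≤
  in cong₂ _*_ (F≈F' ν (proj₁ (valid v)) (ℕₚ.≤-trans (ℕₚ.m≤m+n (degree ν) (degree ρ)) deg≤'))
               (G≈G' ρ (proj₂ (valid v)) (ℕₚ.≤-trans (ℕₚ.m≤n+m (degree ρ) (degree ν)) deg≤')))

⊗-congʳ-≈[] : ∀ {a n X F G} → Homogeneous a X → F ≈[ n ] G → (X ⊗ F) ≈[ a ℕ.+ n ] (X ⊗ G)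
⊗-congʳ-≈[] {a} {n} {X} {F} {G} homX F≈G μ v deg≡ = ⊗-congOnSplits X F X G μ agree
  where
  agree : ∀ ν ρ → IsSplitOf μ (ν , ρ) → X ν * F ρ ≡ X ν * G ρ
  agree ν ρ s with degree ν ℕ.≟ a
  ... | no ν≢  = trans (cong (_* F ρ) (homX ν ν≢))
                   (trans (ℚₚ.*-zeroˡ (F ρ)) (sym (trans (cong (_* G ρ) (homX ν ν≢)) (ℚₚ.*-zeroˡ (G ρ)))))
  ... | yes ν≡ = cong (X ν *_) (F≈G ρ (proj₂ (IsSplitOf.valid s v))
                   (ℕₚ.+-cancelˡ-≡ a (degree ρ) n (trans (cong (ℕ._+ degree ρ) (sym ν≡))
                                                         (trans (IsSplitOf.degree-+ s) deg≡))))

D : Series → Series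
D F μ = ℕtoℚ (degree μ) * F μ

D-cong : ∀ {F G} → F ≗ G → D F ≗ D G
D-cong F≗G μ = cong (ℕtoℚ (degree μ) *_) (F≗G μ)

D-⊗ : ∀ F G → D (F ⊗ G) ≗ ((D F ⊗ G) ⊕ (F ⊗ D G))
D-⊗ F G μ = begin
  ℕtoℚ (degree μ) * (F ⊗ G) μ
    ≡⟨ sumℚ-*ˡ (ℕtoℚ (degree μ)) (λ (ν , ρ) → F ν * G ρ) (splits μ) ⟩
  sumℚ (map (λ (ν , ρ) → ℕtoℚ (degree μ) * (F ν * G ρ)) (splits μ))
    ≡⟨ sumℚ-congAll (All.map (λ {(ν , ρ)} → leibniz ν ρ) (splits-sound μ)) ⟩
  sumℚ (map (λ (ν , ρ) → D F ν * G ρ + F ν * D G ρ) (splits μ))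
    ≡⟨ sumℚ-+ (λ (ν , ρ) → D F ν * G ρ) (λ (ν , ρ) → F ν * D G ρ) (splits μ) ⟩
  ((D F ⊗ G) ⊕ (F ⊗ D G)) μ ∎
  where
  open ≡-Reasoning
  leibniz : ∀ ν ρ → IsSplitOf μ (ν , ρ) → ℕtoℚ (degree μ) * (F ν * G ρ) ≡ D F ν * G ρ + F ν * D G ρ
  leibniz ν ρ s = trans (cong (λ n → ℕtoℚ n * (F ν * G ρ)) (sym (IsSplitOf.degree-+ s)))
    (trans (cong (_* (F ν * G ρ)) (ℕtoℚ-+ (degree ν) (degree ρ)))
      (solve 4 (λ x y f g → (x :+ y) :* (f :* g) := (x :* f) :* g :+ f :* (y :* g))
             refl (ℕtoℚ (degree ν)) (ℕtoℚ (degree ρ)) (F ν) (G ρ)))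

-- Generating series and the logarithmic derivative

Series-setoid : Setoid _ _
Series-setoid = CommutativeSemiring.setoid Series-commutativeSemiring

-- Hgen = ∏ (1 - x_{i,j})⁻¹ and Egen = ∏ (1 - x_{i,j}), written coefficientwise.
Hgen : Series
Hgen μ = 1ℚ

coeff[1-x] : ℕ → ℚ
coeff[1-x] zero          = 1ℚ
coeff[1-x] (suc zero)    = - 1ℚ
coeff[1-x] (suc (suc _)) = 0ℚ

Egen : Series
Egen []                = 1ℚ
Egen ((i , j , e) ∷ μ) = coeff[1-x] e * Egen μ

Pgen : Series
Pgen []                    = 0ℚ
Pgen ((i , j , zero) ∷ μ)  = Pgen μ
Pgen ((i , j , suc e) ∷ μ) = ℕtoℚ i * oneS μ

oneS-exponentSum0 : ∀ μ → exponentSum μ ≡ 0 → oneS μ ≡ 1ℚ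
oneS-exponentSum0 []                   _ = refl
oneS-exponentSum0 ((i , j , zero) ∷ μ) e = oneS-exponentSum0 μ e

Egen-exponentSum0 : ∀ μ → exponentSum μ ≡ 0 → Egen μ ≡ 1ℚ
Egen-exponentSum0 []                   _ = refl
Egen-exponentSum0 ((i , j , zero) ∷ μ) e = trans (ℚₚ.*-identityˡ (Egen μ)) (Egen-exponentSum0 μ e)

D-oneS : D oneS ≗ zeroS
D-oneS []                    = ℚₚ.*-zeroˡ 1ℚ
D-oneS ((i , j , zero) ∷ μ)  = trans (cong (λ n → ℕtoℚ (n ℕ.+ degree μ) * oneS μ) (ℕₚ.*-zeroʳ i)) (D-oneS μ)
D-oneS ((i , j , suc e) ∷ μ) = ℚₚ.*-zeroʳ (ℕtoℚ (degree ((i , j , suc e) ∷ μ)))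

D-Hgen : D Hgen ≗ (Pgen ⊗ Hgen)
D-Hgen []                = refl
D-Hgen ((i , j , e) ∷ μ) = begin
  ℕtoℚ (i ℕ.* e ℕ.+ degree μ) * 1ℚ                ≡⟨ ℚₚ.*-identityʳ (ℕtoℚ (i ℕ.* e ℕ.+ degree μ)) ⟩
  ℕtoℚ (i ℕ.* e ℕ.+ degree μ)                     ≡⟨ trans (ℕtoℚ-+ (i ℕ.* e) (degree μ)) (ℚₚ.+-comm (ℕtoℚ (i ℕ.* e)) (ℕtoℚ (degree μ))) ⟩
  ℕtoℚ (degree μ) + ℕtoℚ (i ℕ.* e)                ≡⟨ cong₂ _+_ (trans (sym (ℚₚ.*-identityʳ (ℕtoℚ (degree μ)))) (D-Hgen μ))
                                                           (trans (cong ℕtoℚ (ℕₚ.*-comm i e)) (ℕtoℚ-* e i)) ⟩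
  (Pgen ⊗ Hgen) μ + ℕtoℚ e * ℕtoℚ i               ≡⟨ cong ((Pgen ⊗ Hgen) μ +_) (trans (∑-cong e pureTerm) (∑-const e (ℕtoℚ i))) ⟨
  (Pgen ⊗ Hgen) μ + ∑ e (λ a → (curryS Pgen (i , j , suc a) ⊗ Hgen) μ) ≡⟨ ⊗-∷ Pgen Hgen i j e μ ⟨
  (Pgen ⊗ Hgen) ((i , j , e) ∷ μ)                 ∎
  where
  open ≡-Reasoning
  pureTerm : ∀ a → (curryS Pgen (i , j , suc a) ⊗ Hgen) μ ≡ ℕtoℚ i
  pureTerm a = trans (⊗-·ˡ (ℕtoℚ i) oneS Hgen μ) (trans (cong (ℕtoℚ i *_) (⊗-identityˡ Hgen μ)) (ℚₚ.*-identityʳ (ℕtoℚ i)))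
  ∑-const : ∀ n c → ∑ n (λ _ → c) ≡ ℕtoℚ n * c
  ∑-const zero    c = sym (ℚₚ.*-zeroˡ c)
  ∑-const (suc n) c = begin
    c + ∑ n (λ _ → c)     ≡⟨ cong₂ _+_ (sym (ℚₚ.*-identityˡ c)) (∑-const n c) ⟩
    1ℚ * c + ℕtoℚ n * c   ≡⟨ ℚₚ.*-distribʳ-+ c 1ℚ (ℕtoℚ n) ⟨
    (1ℚ + ℕtoℚ n) * c     ≡⟨ cong (_* c) (ℕtoℚ-+ 1 n) ⟨
    ℕtoℚ (suc n) * c      ∎

Egen⊗Hgen : (Egen ⊗ Hgen) ≗ oneS
Egen⊗Hgen []                = refl
Egen⊗Hgen ((i , j , e) ∷ μ) = begin
  (Egen ⊗ Hgen) ((i , j , e) ∷ μ)                    ≡⟨ ⊗-∷ Egen Hgen i j e μ ⟩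
  ∑ (suc e) (λ a → (curryS Egen (i , j , a) ⊗ Hgen) μ) ≡⟨ ∑-cong (suc e) (λ a → ⊗-·ˡ (coeff[1-x] a) Egen Hgen μ) ⟩
  ∑ (suc e) (λ a → coeff[1-x] a * (Egen ⊗ Hgen) μ)   ≡⟨ ∑-*ʳ (suc e) ((Egen ⊗ Hgen) μ) coeff[1-x] ⟨
  ∑ (suc e) coeff[1-x] * (Egen ⊗ Hgen) μ             ≡⟨ cong₂ _*_ (telescope e) (Egen⊗Hgen μ) ⟩
  oneS ((i , j , e) ∷ []) * oneS μ                   ≡⟨ lemma e ⟩
  oneS ((i , j , e) ∷ μ)                              ∎
  where
  open ≡-Reasoning
  telescope : ∀ e → ∑ (suc e) coeff[1-x] ≡ oneS ((i , j , e) ∷ [])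
  telescope zero    = refl
  telescope (suc e) = cong (λ z → 1ℚ + (- 1ℚ + z)) (∑-zero e (λ _ → refl))
  lemma : ∀ e → oneS ((i , j , e) ∷ []) * oneS μ ≡ oneS ((i , j , e) ∷ μ)
  lemma zero    = ℚₚ.*-identityˡ (oneS μ)
  lemma (suc e) = ℚₚ.*-zeroˡ (oneS μ)

D-Egen : D Egen ≗ ((- 1ℚ) · (Pgen ⊗ Egen))
D-Egen = begin
  D Egen                          ≈⟨ ⊗-identityʳ (D Egen) ⟨
  D Egen ⊗ oneS                   ≈⟨ ⊗-congʳ (D Egen) (λ μ → trans (⊗-comm Hgen Egen μ) (Egen⊗Hgen μ)) ⟨
  D Egen ⊗ (Hgen ⊗ Egen)          ≈⟨ ⊗-assoc (D Egen) Hgen Egen ⟨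
  (D Egen ⊗ Hgen) ⊗ Egen          ≈⟨ ⊗-congˡ Egen D-Egen⊗Hgen ⟩
  ((- 1ℚ) · Pgen) ⊗ Egen          ≈⟨ ⊗-·ˡ (- 1ℚ) Pgen Egen ⟩
  (- 1ℚ) · (Pgen ⊗ Egen)          ∎
  where
  open SetoidReasoning Series-setoid
  Egen⊗D-Hgen : (Egen ⊗ D Hgen) ≗ Pgen
  Egen⊗D-Hgen = begin
    Egen ⊗ D Hgen                 ≈⟨ ⊗-congʳ Egen D-Hgen ⟩
    Egen ⊗ (Pgen ⊗ Hgen)          ≈⟨ ⊗-congʳ Egen (⊗-comm Pgen Hgen) ⟩
    Egen ⊗ (Hgen ⊗ Pgen)          ≈⟨ ⊗-assoc Egen Hgen Pgen ⟨
    (Egen ⊗ Hgen) ⊗ Pgen          ≈⟨ ⊗-congˡ Pgen Egen⊗Hgen ⟩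
    oneS ⊗ Pgen                   ≈⟨ ⊗-identityˡ Pgen ⟩
    Pgen                          ∎
  D-Egen⊗Hgen : (D Egen ⊗ Hgen) ≗ ((- 1ℚ) · Pgen)
  D-Egen⊗Hgen μ = trans (solve 2 (λ a p → a := (a :+ p) :+ (:- con 1ℚ) :* p) refl ((D Egen ⊗ Hgen) μ) (Pgen μ))
                        (trans (cong (_+ (- 1ℚ) * Pgen μ) sum≡0) (ℚₚ.+-identityˡ _))
    where
    sum≡0 : (D Egen ⊗ Hgen) μ + Pgen μ ≡ 0ℚ
    sum≡0 = trans (cong ((D Egen ⊗ Hgen) μ +_) (sym (Egen⊗D-Hgen μ)))
                  (trans (sym (D-⊗ Egen Hgen μ)) (trans (D-cong Egen⊗Hgen μ) (D-oneS μ)))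

Pgen-vanishesBelow-1 : VanishesBelow 1 Pgen
Pgen-vanishesBelow-1 []                    _         = refl
Pgen-vanishesBelow-1 ((i , j , zero) ∷ μ)  size<1    = Pgen-vanishesBelow-1 μ size<1
Pgen-vanishesBelow-1 ((i , j , suc e) ∷ μ) (s≤s ())

-- ∑_{ℓ≥1} (-1)^{ℓ-1} X^ℓ / ℓ is log B, and D (a factor degree μ on the coefficient of μ) maps it to
-- D B / B = s·Pgen.  Truncating at ℓ ≤ N is harmless at μ because X^ℓ vanishes below exponent sum ℓ.
module LogarithmicDerivative (B X : Series) (s : ℚ)
  (B≗1+X : B ≗ (oneS ⊕ X)) (X-vanishesBelow-1 : VanishesBelow 1 X) (D-B : D B ≗ (s · (Pgen ⊗ B))) where

  D-X : D X ≗ (s · (Pgen ⊗ B))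
  D-X μ = begin
    D X μ                        ≡⟨ ℚₚ.+-identityˡ (D X μ) ⟨
    0ℚ + D X μ                   ≡⟨ cong (_+ D X μ) (D-oneS μ) ⟨
    D oneS μ + D X μ             ≡⟨ ℚₚ.*-distribˡ-+ (ℕtoℚ (degree μ)) (oneS μ) (X μ) ⟨
    D (oneS ⊕ X) μ               ≡⟨ D-cong B≗1+X μ ⟨
    D B μ                        ≡⟨ D-B μ ⟩
    (s · (Pgen ⊗ B)) μ           ∎
    where open ≡-Reasoning

  D-^ : ∀ n → D (X ^ suc n) ≗ (ℕtoℚ (suc n) · ((X ^ n) ⊗ D X))
  D-^ zero μ = begin
    D (X ⊗ oneS) μ                ≡⟨ D-cong (⊗-identityʳ X) μ ⟩
    D X μ                         ≡⟨ trans (sym (⊗-identityˡ (D X) μ)) (sym (ℚₚ.*-identityˡ _)) ⟩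
    1ℚ * (oneS ⊗ D X) μ           ∎
    where open ≡-Reasoning
  D-^ (suc n) μ = begin
    D (X ⊗ (X ^ suc n)) μ
      ≡⟨ D-⊗ X (X ^ suc n) μ ⟩
    (D X ⊗ (X ^ suc n)) μ + (X ⊗ D (X ^ suc n)) μ
      ≡⟨ cong₂ _+_ (⊗-comm (D X) (X ^ suc n) μ) (⊗-congʳ X (D-^ n) μ) ⟩
    ((X ^ suc n) ⊗ D X) μ + (X ⊗ (ℕtoℚ (suc n) · ((X ^ n) ⊗ D X))) μ
      ≡⟨ cong (((X ^ suc n) ⊗ D X) μ +_) (trans (⊗-·ʳ (ℕtoℚ (suc n)) X ((X ^ n) ⊗ D X) μ)
                                              (cong (ℕtoℚ (suc n) *_) (sym (⊗-assoc X (X ^ n) (D X) μ)))) ⟩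
    ((X ^ suc n) ⊗ D X) μ + ℕtoℚ (suc n) * ((X ^ suc n) ⊗ D X) μ
      ≡⟨ solve 2 (λ z c → z :+ c :* z := (con 1ℚ :+ c) :* z) refl (((X ^ suc n) ⊗ D X) μ) (ℕtoℚ (suc n)) ⟩
    (1ℚ + ℕtoℚ (suc n)) * ((X ^ suc n) ⊗ D X) μ
      ≡⟨ cong (_* ((X ^ suc n) ⊗ D X) μ) (ℕtoℚ-+ 1 (suc n)) ⟨
    ℕtoℚ (suc (suc n)) * ((X ^ suc n) ⊗ D X) μ ∎
    where open ≡-Reasoning

  frac-*-^ : ∀ l μ → frac (degree μ) (suc l) * (X ^ suc l) μ ≡ s * ((X ^ l) ⊗ (Pgen ⊗ B)) μ
  frac-*-^ l μ = trans (ℕtoℚ-suc-cancelˡ l (begin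
    ℕtoℚ (suc l) * (frac (degree μ) (suc l) * (X ^ suc l) μ) ≡⟨ ℚₚ.*-assoc (ℕtoℚ (suc l)) _ _ ⟨
    ℕtoℚ (suc l) * frac (degree μ) (suc l) * (X ^ suc l) μ   ≡⟨ cong (_* (X ^ suc l) μ)
                                                                   (trans (ℚₚ.*-comm (ℕtoℚ (suc l)) _) (frac-*-ℕtoℚ (degree μ) l)) ⟩
    D (X ^ suc l) μ                                           ≡⟨ D-^ l μ ⟩
    ℕtoℚ (suc l) * ((X ^ l) ⊗ D X) μ                          ∎))
    (trans (⊗-congʳ (X ^ l) D-X μ) (⊗-·ʳ s (X ^ l) (Pgen ⊗ B) μ))
    where open ≡-Reasoning

  alternating : ℕ → Series
  alternating N = ∑S N (λ l → sign l · (X ^ l))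

  alternating⊗B : ∀ N → (alternating N ⊗ B) ≗ (oneS ⊕ ((- sign N) · (X ^ N)))
  alternating⊗B zero μ = trans (⊗-zeroˡ B μ) (sym (solve 1 (λ o → o :+ (:- con 1ℚ) :* o := con 0ℚ) refl (oneS μ)))
  alternating⊗B (suc N) μ = begin
    (alternating (suc N) ⊗ B) μ
      ≡⟨ ⊗-congˡ B (λ ν → ∑-last N (λ l → (sign l · (X ^ l)) ν)) μ ⟩
    ((alternating N ⊕ (sign N · (X ^ N))) ⊗ B) μ
      ≡⟨ ⊗-distribʳ B (alternating N) (sign N · (X ^ N)) μ ⟩
    (alternating N ⊗ B) μ + ((sign N · (X ^ N)) ⊗ B) μ
      ≡⟨ cong₂ _+_ (alternating⊗B N μ) (trans (⊗-·ˡ (sign N) (X ^ N) B μ) (cong (sign N *_) X^N⊗B)) ⟩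
    oneS μ + (- sign N) * (X ^ N) μ + sign N * ((X ^ N) μ + (X ^ suc N) μ)
      ≡⟨ solve 4 (λ o s a b → o :+ (:- s) :* a :+ s :* (a :+ b) := o :+ (:- (:- s)) :* b)
               refl (oneS μ) (sign N) ((X ^ N) μ) ((X ^ suc N) μ) ⟩
    oneS μ + (- sign (suc N)) * (X ^ suc N) μ ∎
    where
    open ≡-Reasoning
    X^N⊗B : ((X ^ N) ⊗ B) μ ≡ (X ^ N) μ + (X ^ suc N) μ
    X^N⊗B = trans (⊗-congʳ (X ^ N) B≗1+X μ)
                  (trans (⊗-distribˡ (X ^ N) oneS X μ) (cong₂ _+_ (⊗-identityʳ (X ^ N) μ) (⊗-comm (X ^ N) X μ)))

  ^-vanishesBelow : ∀ N → VanishesBelow N (X ^ N)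
  ^-vanishesBelow zero    μ ()
  ^-vanishesBelow (suc N) = ⊗-vanishesBelow X-vanishesBelow-1 (^-vanishesBelow N)

  log-expansion : ∀ N μ → exponentSum μ ≤ N →
    ∑ (suc N) (λ ℓ → (sign (ℓ ∸ 1) * frac (degree μ) ℓ) * (X ^ ℓ) μ) ≡ s * Pgen μ
  log-expansion N μ size≤N = begin
    ∑ (suc N) (λ ℓ → (sign (ℓ ∸ 1) * frac (degree μ) ℓ) * (X ^ ℓ) μ)
      ≡⟨ trans (cong (_+ ∑≥1) (ℚₚ.*-zeroˡ (oneS μ))) (ℚₚ.+-identityˡ ∑≥1) ⟩
    ∑≥1
      ≡⟨ ∑-cong N (λ l → trans (ℚₚ.*-assoc (sign l) _ _) (cong (sign l *_) (frac-*-^ l μ))) ⟩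
    ∑ N (λ l → sign l * (s * ((X ^ l) ⊗ (Pgen ⊗ B)) μ))
      ≡⟨ ∑-cong N (λ l → solve 3 (λ a b c → a :* (b :* c) := b :* (a :* c)) refl (sign l) s _) ⟩
    ∑ N (λ l → s * (sign l * ((X ^ l) ⊗ (Pgen ⊗ B)) μ))
      ≡⟨ ∑-*ˡ N s _ ⟨
    s * ∑ N (λ l → sign l * ((X ^ l) ⊗ (Pgen ⊗ B)) μ)
      ≡⟨ cong (s *_) (∑-cong N (λ l → ⊗-·ˡ (sign l) (X ^ l) (Pgen ⊗ B) μ)) ⟨
    s * ∑ N (λ l → ((sign l · (X ^ l)) ⊗ (Pgen ⊗ B)) μ)
      ≡⟨ cong (s *_) (⊗-∑Sˡ N (λ l → sign l · (X ^ l)) (Pgen ⊗ B) μ) ⟨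
    s * (alternating N ⊗ (Pgen ⊗ B)) μ
      ≡⟨ cong (s *_) (trans (⊗-congʳ (alternating N) (⊗-comm Pgen B) μ)
                     (trans (sym (⊗-assoc (alternating N) B Pgen μ)) (⊗-congˡ Pgen (alternating⊗B N) μ))) ⟩
    s * ((oneS ⊕ ((- sign N) · (X ^ N))) ⊗ Pgen) μ
      ≡⟨ cong (s *_) (trans (⊗-distribʳ Pgen oneS _ μ) (cong₂ _+_ (⊗-identityˡ Pgen μ) remainder≡0)) ⟩
    s * (Pgen μ + 0ℚ)
      ≡⟨ cong (s *_) (ℚₚ.+-identityʳ _) ⟩
    s * Pgen μ ∎
    where
    open ≡-Reasoning
    ∑≥1 : ℚ
    ∑≥1 = ∑ N (λ l → (sign l * frac (degree μ) (suc l)) * (X ^ suc l) μ)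
    remainder≡0 : (((- sign N) · (X ^ N)) ⊗ Pgen) μ ≡ 0ℚ
    remainder≡0 = trans (⊗-·ˡ (- sign N) (X ^ N) Pgen μ)
      (trans (cong ((- sign N) *_) (⊗-vanishesBelow (^-vanishesBelow N) Pgen-vanishesBelow-1 μ
                                      (subst (exponentSum μ <_) (ℕₚ.+-comm 1 N) (s≤s size≤N))))
             (ℚₚ.*-zeroʳ (- sign N)))

-- Multisets of stacks

-- Built with _×-dec_ so that does (s ≟S t) reduces to s ≡ᵇS t.
_≟S_ : DecidableEquality Stack
(a , b) ≟S (c , d) = Dec.map′ (λ (p , q) → cong₂ _,_ p q) ,-injective ((a ℕ.≟ c) ×-dec (b ℕ.≟ d))

open import Data.List.Membership.DecPropositional _≟S_ using (_∈?_)

-- For _≟S_ and ℕ._≟_, count is definitionally countS and mult of Defs.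
module Counting {A : Set} (_≟_ : DecidableEquality A) where

  count : A → List A → ℕ
  count x = length ∘ filterᵇ (does ∘ (x ≟_))

  count-here : ∀ x l → count x (x ∷ l) ≡ suc (count x l)
  count-here x l = cong length (Listₚ.filter-accept (T? ∘ does ∘ (x ≟_)) (subst Bool.T (sym (Dec.dec-true (x ≟ x) refl)) _))

  count-there : ∀ {x y} l → x ≢ y → count x (y ∷ l) ≡ count x l
  count-there {x} {y} l x≢y =
    cong length (Listₚ.filter-reject (T? ∘ does ∘ (x ≟_)) (subst Bool.T (Dec.dec-false (x ≟ y) x≢y)))

  count-++ : ∀ x l l' → count x (l ++ l') ≡ count x l ℕ.+ count x l'
  count-++ x l l' = trans (cong length (Listₚ.filter-++ (T? ∘ does ∘ (x ≟_)) l l'))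
                          (Listₚ.length-++ (filterᵇ (does ∘ (x ≟_)) l))

  count≢0⇒∈ : ∀ {x} l → count x l ≢ 0 → x ∈ l
  count≢0⇒∈     []      count≢0 = ⊥-elim (count≢0 refl)
  count≢0⇒∈ {x} (y ∷ l) count≢0 with Dec.toSum (x ≟ y)
  ... | inj₁ refl = here refl
  ... | inj₂ x≢y  = there (count≢0⇒∈ l (count≢0 ∘ trans (count-there {x} {y} l x≢y)))

  ∉⇒count≡0 : ∀ {x} l → x ∉ l → count x l ≡ 0
  ∉⇒count≡0     []      x∉l = refl
  ∉⇒count≡0 {x} (y ∷ l) x∉l with Dec.toSum (x ≟ y)
  ... | inj₁ refl = ⊥-elim (x∉l (here refl))
  ... | inj₂ x≢y  = trans (count-there {x} {y} l x≢y) (∉⇒count≡0 l (x∉l ∘ there))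

  ∈⇒count≢0 : ∀ {x l} → x ∈ l → count x l ≢ 0
  ∈⇒count≢0 {x} {y ∷ l} x∈yl count≡0 with Dec.toSum (x ≟ y) | x∈yl
  ... | inj₁ refl | _         = ℕₚ.0≢1+n (sym (trans (sym (count-here x l)) count≡0))
  ... | inj₂ x≢y  | here x≡y  = x≢y x≡y
  ... | inj₂ x≢y  | there x∈l = ∈⇒count≢0 x∈l (trans (sym (count-there {x} {y} l x≢y)) count≡0)

open Counting _≟S_ using () renaming
  (count-here to countS-here; count-there to countS-there; count-++ to countS-++;
   count≢0⇒∈ to countS≢0⇒∈; ∈⇒count≢0 to ∈⇒countS≢0)

infix 4 _≋_
_≋_ : List Stack → List Stack → Set
A ≋ B = ∀ s → countS s A ≡ countS s B

≋-∈ : ∀ {A B t} → A ≋ B → t ∈ A → t ∈ B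
≋-∈ {A} {B} {t} A≋B t∈A = countS≢0⇒∈ B (∈⇒countS≢0 t∈A ∘ trans (A≋B t))

≋-∷ : ∀ s {A B} → A ≋ B → (s ∷ A) ≋ (s ∷ B)
≋-∷ s {A} {B} A≋B t with t ≟S s
... | yes refl = trans (countS-here t A) (trans (cong suc (A≋B t)) (sym (countS-here t B)))
... | no t≢s   = trans (countS-there A t≢s) (trans (A≋B t) (sym (countS-there B t≢s)))

≋-∷⁻ : ∀ s {A B} → (s ∷ A) ≋ (s ∷ B) → A ≋ B
≋-∷⁻ s {A} {B} sA≋sB t with t ≟S s
... | yes refl = ℕₚ.suc-injective (trans (sym (countS-here t A)) (trans (sA≋sB t) (countS-here t B)))
... | no t≢s   = trans (sym (countS-there A t≢s)) (trans (sA≋sB t) (countS-there B t≢s))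

≋-swap : ∀ a b l → (a ∷ b ∷ l) ≋ (b ∷ a ∷ l)
≋-swap a b l t with t ≟S a | t ≟S b
... | yes refl | yes refl = refl
... | yes refl | no t≢b   = trans (countS-here t (b ∷ l)) (trans (cong suc (countS-there l t≢b))
                              (trans (sym (countS-here t l)) (sym (countS-there (t ∷ l) t≢b))))
... | no t≢a   | yes refl = trans (countS-there (t ∷ l) t≢a) (trans (countS-here t l)
                              (trans (cong suc (sym (countS-there l t≢a))) (sym (countS-here t (a ∷ l)))))
... | no t≢a   | no t≢b   = trans (countS-there (b ∷ l) t≢a) (trans (countS-there l t≢b)
                              (sym (trans (countS-there (a ∷ l) t≢b) (countS-there l t≢a))))

remove : Stack → List Stack → List Stack
remove s []      = []
remove s (t ∷ l) with s ≟S t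
... | yes _ = l
... | no _  = t ∷ remove s l

≋-remove : ∀ {s} l → s ∈ l → l ≋ (s ∷ remove s l)
≋-remove {s} (t ∷ l) s∈tl with s ≟S t | s∈tl
... | yes refl | _           = λ _ → refl
... | no s≢t   | here s≡t    = ⊥-elim (s≢t s≡t)
... | no s≢t   | there s∈l   = λ u → trans (≋-∷ t (≋-remove l s∈l) u) (≋-swap t s (remove s l) u)

All-remove : ∀ {P : Stack → Set} s {l} → All P l → All P (remove s l)
All-remove s {[]}    []       = []
All-remove s {t ∷ l} (p ∷ ps) with s ≟S t
... | yes _ = ps
... | no _  = p ∷ All-remove s ps

sumBy : (Stack → ℕ) → List Stack → ℕ
sumBy h []      = 0
sumBy h (s ∷ l) = h s ℕ.+ sumBy h l

sumBy-remove : ∀ h {s} l → s ∈ l → sumBy h l ≡ h s ℕ.+ sumBy h (remove s l)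
sumBy-remove h {s} (t ∷ l) s∈tl with s ≟S t | s∈tl
... | yes refl | _         = refl
... | no s≢t   | here s≡t  = ⊥-elim (s≢t s≡t)
... | no s≢t   | there s∈l = trans (cong (h t ℕ.+_) (sumBy-remove h l s∈l)) (x+[y+z]≡y+[x+z] (h t) (h s) _)

≋-[] : ∀ {B} → [] ≋ B → B ≡ []
≋-[] {[]}    _    = refl
≋-[] {b ∷ B} []≋B = ⊥-elim (ℕₚ.0≢1+n (trans ([]≋B b) (countS-here b B)))

≋⇒sumBy≡ : ∀ h A B → A ≋ B → sumBy h A ≡ sumBy h B
≋⇒sumBy≡ h []      B []≋B rewrite ≋-[] {B} []≋B = refl
≋⇒sumBy≡ h (a ∷ A) B aA≋B = begin
  h a ℕ.+ sumBy h A                  ≡⟨ cong (h a ℕ.+_) (≋⇒sumBy≡ h A (remove a B) (≋-∷⁻ a A≋aB′)) ⟩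
  h a ℕ.+ sumBy h (remove a B)       ≡⟨ sumBy-remove h B a∈B ⟨
  sumBy h B                          ∎
  where
  open ≡-Reasoning
  a∈B : a ∈ B
  a∈B = ≋-∈ {a ∷ A} {B} aA≋B (here refl)
  A≋aB′ : (a ∷ A) ≋ (a ∷ remove a B)
  A≋aB′ s = trans (aA≋B s) (≋-remove B a∈B s)

≋⇒length≡ : ∀ A B → A ≋ B → length A ≡ length B
≋⇒length≡ A B A≋B = trans (length≡sumBy A) (trans (≋⇒sumBy≡ (λ _ → 1) A B A≋B) (sym (length≡sumBy B)))
  where
  length≡sumBy : ∀ l → length l ≡ sumBy (λ _ → 1) l
  length≡sumBy []      = refl
  length≡sumBy (_ ∷ l) = cong suc (length≡sumBy l)

≋-[_] : ∀ s {A} → A ≋ (s ∷ []) → A ≡ s ∷ []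
≋-[ s ] {[]}        A≋[s] = ⊥-elim (ℕₚ.0≢1+n (trans (A≋[s] s) (countS-here s [])))
≋-[ s ] {t ∷ u ∷ A} A≋[s] = ⊥-elim (ℕₚ.1+n≢0 (ℕₚ.suc-injective (≋⇒length≡ (t ∷ u ∷ A) (s ∷ []) A≋[s])))
≋-[ s ] {t ∷ []}    A≋[s] with ≋-∈ {t ∷ []} {s ∷ []} A≋[s] (here refl)
... | here refl = refl

allB⁻ : ∀ {A : Set} (p : A → Bool) xs → Bool.T (allB p xs) → All (Bool.T ∘ p) xs
allB⁻ p []       _  = []
allB⁻ p (x ∷ xs) px∧ = proj₁ (Equivalence.to T-∧ px∧) ∷ allB⁻ p xs (proj₂ (Equivalence.to T-∧ px∧))

allB⁺ : ∀ {A : Set} (p : A → Bool) xs → All (Bool.T ∘ p) xs → Bool.T (allB p xs)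
allB⁺ p []       []         = _
allB⁺ p (x ∷ xs) (px ∷ pxs) = Equivalence.from T-∧ (px , allB⁺ p xs pxs)

sameMultiset-reflects : ∀ A B → Reflects (A ≋ B) (sameMultiset A B)
sameMultiset-reflects A B = fromEquivalence sound complete
  where
  sound : Bool.T (sameMultiset A B) → A ≋ B
  sound same s with countS s (A ++ B) ℕ.≟ 0
  ... | no ≢0 = ℕₚ.≡ᵇ⇒≡ _ _ (All.lookup (allB⁻ _ (A ++ B) same) (countS≢0⇒∈ {s} (A ++ B) ≢0))
  ... | yes ≡0 = trans (ℕₚ.m+n≡0⇒m≡0 _ sum≡0) (sym (ℕₚ.m+n≡0⇒n≡0 (countS s A) sum≡0))
    where
    sum≡0 : countS s A ℕ.+ countS s B ≡ 0
    sum≡0 = trans (sym (countS-++ s A B)) ≡0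
  complete : A ≋ B → Bool.T (sameMultiset A B)
  complete A≋B = allB⁺ _ (A ++ B) (All.tabulate (λ {s} _ → ℕₚ.≡⇒≡ᵇ _ _ (A≋B s)))

reflects-⇔ : ∀ {P Q : Set} {b} → (P → Q) → (Q → P) → Reflects P b → Reflects Q b
reflects-⇔ f g (ofʸ p)  = ofʸ (f p)
reflects-⇔ f g (ofⁿ ¬p) = ofⁿ (¬p ∘ g)

sameMultiset-respˡ : ∀ {A A'} B → A ≋ A' → sameMultiset A B ≡ sameMultiset A' B
sameMultiset-respˡ {A} {A'} B A≋A' = det (sameMultiset-reflects A B)
  (reflects-⇔ (λ A'≋B s → trans (A≋A' s) (A'≋B s)) (λ A≋B s → trans (sym (A≋A' s)) (A≋B s))
              (sameMultiset-reflects A' B))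

sameMultiset-∷ : ∀ s A B → sameMultiset (s ∷ A) (s ∷ B) ≡ sameMultiset A B
sameMultiset-∷ s A B = det (sameMultiset-reflects (s ∷ A) (s ∷ B))
  (reflects-⇔ (≋-∷ s) (≋-∷⁻ s) (sameMultiset-reflects A B))

-- Enumerating stack partitions

gate : Bool → ℚ → ℚ
gate b x = if b then x else 0ℚ

gate-0ℚ : ∀ b → gate b 0ℚ ≡ 0ℚ
gate-0ℚ true  = refl
gate-0ℚ false = refl

gate-∧ : ∀ b₁ b₂ x → gate b₁ (gate b₂ x) ≡ gate (b₁ ∧ b₂) x
gate-∧ true  b₂ x = refl
gate-∧ false b₂ x = refl

gate-∑ : ∀ b n (f : ℕ → ℚ) → gate b (∑ n f) ≡ ∑ n (gate b ∘ f)
gate-∑ true  n f = refl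
gate-∑ false n f = sym (∑-zero n (λ _ → refl))

indicator : Bool → ℚ
indicator b = gate b 1ℚ

PositiveWeights : List Stack → Set
PositiveWeights = All (λ s → 1 ≤ weight s)

1+n∸w≤n : ∀ n {w} → 1 ≤ w → suc n ∸ w ≤ n
1+n∸w≤n n {suc w} _ = ℕₚ.m∸n≤m n w

sumℚ-sp-∷ : ∀ (g : List Stack → ℚ) f n s rest →
  sumℚ (map g (sp (suc f) (suc n) (s ∷ rest)))
    ≡ (if weight s ≤ᵇ suc n then sumℚ (map (g ∘ (s ∷_)) (sp f (suc n ∸ weight s) (s ∷ rest))) else 0ℚ)
      + sumℚ (map g (sp (suc f) (suc n) rest))
sumℚ-sp-∷ g f n s rest with weight s ≤ᵇ suc n
... | true  = trans (cong sumℚ (Listₚ.map-++ g (map (s ∷_) first) later))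
                    (trans (sumℚ-++ (map g (map (s ∷_) first)) (map g later))
                           (cong (_+ sumℚ (map g later)) (sumℚ-map-map g (s ∷_) first)))
  where
  first : List (List Stack)
  first = sp f (suc n ∸ weight s) (s ∷ rest)
  later : List (List Stack)
  later = sp (suc f) (suc n) rest
... | false = sym (ℚₚ.+-identityˡ _)

sp-fuel : ∀ f f' n c → n ≤ f → n ≤ f' → PositiveWeights c → sp f n c ≡ sp f' n c
sp-fuel f f' zero c _ _ _ = refl
sp-fuel (suc f) (suc f') (suc n) [] _ _ _ = refl
sp-fuel (suc f) (suc f') (suc n) (s ∷ rest) (s≤s n≤f) (s≤s n≤f') (1≤w ∷ pos) =
  cong₂ _++_ (cong (λ l → if weight s ≤ᵇ suc n then map (s ∷_) l else [])
                   (sp-fuel f f' (suc n ∸ weight s) (s ∷ rest) (ℕₚ.≤-trans (1+n∸w≤n n 1≤w) n≤f)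
                            (ℕₚ.≤-trans (1+n∸w≤n n 1≤w) n≤f') (1≤w ∷ pos)))
             (sp-fuel (suc f) (suc f') (suc n) rest (s≤s n≤f) (s≤s n≤f') pos)

sp-All : ∀ {P : Stack → Set} f n c → All P c → All (All P) (sp f n c)
sp-All zero    zero    c ps = [] ∷ []
sp-All (suc f) zero    c ps = [] ∷ []
sp-All zero    (suc n) c ps = []
sp-All (suc f) (suc n) [] ps = []
sp-All {P} (suc f) (suc n) (s ∷ rest) (p ∷ ps) = Allₚ.++⁺ first (sp-All (suc f) (suc n) rest ps)
  where
  first : All (All P) (if weight s ≤ᵇ suc n then map (s ∷_) (sp f (suc n ∸ weight s) (s ∷ rest)) else [])
  first with weight s ≤ᵇ suc n
  ... | true  = Allₚ.map⁺ (All.map (p ∷_) (sp-All f (suc n ∸ weight s) (s ∷ rest) (p ∷ ps)))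
  ... | false = []

sp-weight : ∀ f n c → All (λ τ → sumBy weight τ ≡ n) (sp f n c)
sp-weight f       zero    c = refl ∷ []
sp-weight zero    (suc n) c = []
sp-weight (suc f) (suc n) [] = []
sp-weight (suc f) (suc n) (s ∷ rest) = Allₚ.++⁺ first (sp-weight (suc f) (suc n) rest)
  where
  first : All (λ τ → sumBy weight τ ≡ suc n)
              (if weight s ≤ᵇ suc n then map (s ∷_) (sp f (suc n ∸ weight s) (s ∷ rest)) else [])
  first with weight s ≤ᵇ suc n | ℕₚ.≤ᵇ-reflects-≤ (weight s) (suc n)
  ... | true  | ofʸ w≤ = Allₚ.map⁺ (All.map (λ eq → trans (cong (weight s ℕ.+_) eq) (ℕₚ.m+[n∸m]≡n w≤))
                                           (sp-weight f (suc n ∸ weight s) (s ∷ rest)))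
  ... | false | ofⁿ _  = []

matchCount : List Stack → List (List Stack) → ℚ
matchCount T τs = sumℚ (map (λ τ → indicator (sameMultiset T τ)) τs)

matchCount-none : ∀ T τs → All (λ τ → ¬ T ≋ τ) τs → matchCount T τs ≡ 0ℚ
matchCount-none T τs none =
  trans (sumℚ-congAll (All.map (λ {τ} → cong indicator ∘ no-match τ) none)) (sumℚ-zero τs (λ _ → refl))
  where
  no-match : ∀ τ → ¬ T ≋ τ → sameMultiset T τ ≡ false
  no-match τ ¬T≋τ with sameMultiset T τ | sameMultiset-reflects T τ
  ... | true  | ofʸ T≋τ = contradiction T≋τ ¬T≋τ
  ... | false | _       = refl

matchCount-wrongWeight : ∀ f n c T → sumBy weight T ≢ n → matchCount T (sp f n c) ≡ 0ℚ
matchCount-wrongWeight f n c T weight≢n = matchCount-none T (sp f n c)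
  (All.map (λ {τ} weight≡n T≋τ → weight≢n (trans (≋⇒sumBy≡ weight T τ T≋τ) weight≡n)) (sp-weight f n c))

matchCount-foreign : ∀ f n c T {t} → t ∈ T → t ∉ c → matchCount T (sp f n c) ≡ 0ℚ
matchCount-foreign f n c T {t} t∈T t∉c = matchCount-none T (sp f n c)
  (All.map (λ {τ} τ⊆c T≋τ → t∉c (All.lookup τ⊆c (≋-∈ {T} {τ} T≋τ t∈T))) (sp-All f n c (All.tabulate (λ t∈c → t∈c))))

matchCount-∷-absent : ∀ f n s rest T → s ∉ T →
  matchCount T (sp (suc f) (suc n) rest) ≡ 1ℚ → matchCount T (sp (suc f) (suc n) (s ∷ rest)) ≡ 1ℚ
matchCount-∷-absent f n s rest T s∉T later≡1 = begin
  matchCount T (sp (suc f) (suc n) (s ∷ rest))                         ≡⟨ sumℚ-sp-∷ g f n s rest ⟩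
  (if weight s ≤ᵇ suc n then sumℚ (map (g ∘ (s ∷_)) first) else 0ℚ) + matchCount T later
                                                                       ≡⟨ cong₂ _+_ first≡0 later≡1 ⟩
  0ℚ + 1ℚ                                                             ≡⟨ ℚₚ.+-identityˡ 1ℚ ⟩
  1ℚ                                                                  ∎
  where
  open ≡-Reasoning
  g : List Stack → ℚ
  g τ = indicator (sameMultiset T τ)
  first : List (List Stack)
  first = sp f (suc n ∸ weight s) (s ∷ rest)
  later : List (List Stack)
  later = sp (suc f) (suc n) rest
  first≡0 : (if weight s ≤ᵇ suc n then sumℚ (map (g ∘ (s ∷_)) first) else 0ℚ) ≡ 0ℚ
  first≡0 with weight s ≤ᵇ suc n
  ... | false = refl
  ... | true  = trans (sym (sumℚ-map-map g (s ∷_) first)) (matchCount-none T (map (s ∷_) first)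
                  (Allₚ.map⁺ (All.tabulate (λ {τ} _ T≋sτ → s∉T (≋-∈ {s ∷ τ} {T} (λ u → sym (T≋sτ u)) (here refl))))))

matchCount-∷-present : ∀ f n s rest T → s ∈ T → s ∉ rest → weight s ≤ suc n →
  matchCount (remove s T) (sp f (suc n ∸ weight s) (s ∷ rest)) ≡ 1ℚ →
  matchCount T (sp (suc f) (suc n) (s ∷ rest)) ≡ 1ℚ
matchCount-∷-present f n s rest T s∈T s∉rest w≤1+n first≡1 = begin
  matchCount T (sp (suc f) (suc n) (s ∷ rest))                         ≡⟨ sumℚ-sp-∷ g f n s rest ⟩
  (if weight s ≤ᵇ suc n then sumℚ (map (g ∘ (s ∷_)) first) else 0ℚ) + matchCount T later
                                                                       ≡⟨ cong₂ _+_ first≡ later≡0 ⟩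
  1ℚ + 0ℚ                                                             ≡⟨ ℚₚ.+-identityʳ 1ℚ ⟩
  1ℚ                                                                  ∎
  where
  open ≡-Reasoning
  g : List Stack → ℚ
  g τ = indicator (sameMultiset T τ)
  first : List (List Stack)
  first = sp f (suc n ∸ weight s) (s ∷ rest)
  later : List (List Stack)
  later = sp (suc f) (suc n) rest
  later≡0 : matchCount T later ≡ 0ℚ
  later≡0 = matchCount-foreign (suc f) (suc n) rest T s∈T s∉rest
  first≡ : (if weight s ≤ᵇ suc n then sumℚ (map (g ∘ (s ∷_)) first) else 0ℚ) ≡ 1ℚ
  first≡ with weight s ≤ᵇ suc n | ℕₚ.≤ᵇ-reflects-≤ (weight s) (suc n)
  ... | false | ofⁿ w≰ = contradiction w≤1+n w≰
  ... | true  | ofʸ _  = trans (sumℚ-cong first (λ τ → cong indicator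
                                  (trans (sameMultiset-respˡ {T} {s ∷ remove s T} (s ∷ τ) (≋-remove T s∈T))
                                         (sameMultiset-∷ s (remove s T) τ))))
                                first≡1

matchCount-exactlyOne : ∀ f n c T → n ≤ f → PositiveWeights c → Unique c → All (_∈ c) T → sumBy weight T ≡ n →
  matchCount T (sp f n c) ≡ 1ℚ
matchCount-exactlyOne f zero c [] _ _ _ _ _ = refl
matchCount-exactlyOne f zero c (t ∷ T) _ pos _ (t∈c ∷ _) weight≡0 =
  ⊥-elim (ℕₚ.<⇒≢ (ℕₚ.≤-trans (All.lookup pos t∈c) (ℕₚ.m≤m+n (weight t) (sumBy weight T))) (sym weight≡0))
matchCount-exactlyOne zero (suc n) c T () _ _ _ _
matchCount-exactlyOne (suc f) (suc n) [] [] _ _ _ _ ()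
matchCount-exactlyOne (suc f) (suc n) [] (t ∷ T) _ _ _ (() ∷ _) _
-- A `with` on s ∈? T would hide the lexicographic descent on (f , c) from the termination checker.
matchCount-exactlyOne (suc f) (suc n) (s ∷ rest) T (s≤s n≤f) (1≤w ∷ pos) (s∉rest ∷ unique) T⊆c weight≡n =
  [ (λ s∈T → matchCount-∷-present f n s rest T s∈T (Allₚ.All¬⇒¬Any s∉rest) (w≤1+n s∈T)
               (matchCount-exactlyOne f (suc n ∸ weight s) (s ∷ rest) (remove s T)
                  (ℕₚ.≤-trans (1+n∸w≤n n 1≤w) n≤f) (1≤w ∷ pos) (s∉rest ∷ unique) (All-remove s T⊆c)
                  (trans (sym (ℕₚ.m+n∸m≡n (weight s) _)) (cong (_∸ weight s) (weight≡ s∈T)))))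
  , (λ s∉T → matchCount-∷-absent f n s rest T s∉T
               (matchCount-exactlyOne (suc f) (suc n) rest T (s≤s n≤f) pos unique (T⊆rest s∉T) weight≡n))
  ]′ (Dec.toSum (s ∈? T))
  where
  weight≡ : s ∈ T → weight s ℕ.+ sumBy weight (remove s T) ≡ suc n
  weight≡ s∈T = trans (sym (sumBy-remove weight T s∈T)) weight≡n
  w≤1+n : s ∈ T → weight s ≤ suc n
  w≤1+n s∈T = subst (weight s ≤_) (weight≡ s∈T) (ℕₚ.m≤m+n (weight s) _)
  drop-head : ∀ {t} → t ∈ s ∷ rest → t ≢ s → t ∈ rest
  drop-head (here t≡s)  t≢s = ⊥-elim (t≢s t≡s)
  drop-head (there t∈r) _   = t∈r
  T⊆rest : s ∉ T → All (_∈ rest) T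
  T⊆rest s∉T = All.tabulate (λ {t} t∈T → drop-head (All.lookup T⊆c t∈T) (λ t≡s → s∉T (subst (_∈ T) t≡s t∈T)))

multiplicityBlock : (List Stack → ℚ) → ℕ → Stack → List Stack → ℕ → ℕ → ℚ
multiplicityBlock g f s rest n a =
  if a ℕ.* weight s ≤ᵇ n then sumℚ (map (λ τ → g (replicate a s ++ τ)) (sp f (n ∸ a ℕ.* weight s) rest)) else 0ℚ

sumℚ-sp-byMultiplicity : ∀ g f n s rest M → 1 ≤ weight s → PositiveWeights rest → n ≤ f → n < M →
  sumℚ (map g (sp f n (s ∷ rest))) ≡ ∑ M (multiplicityBlock g f s rest n)
sumℚ-sp-byMultiplicity g f zero s rest (suc M) 1≤w _ _ _ =
  sym (trans (cong (multiplicityBlock g f s rest 0 0 +_) (∑-zero M block-empty)) (ℚₚ.+-identityʳ _))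
  where
  block-empty : ∀ a → multiplicityBlock g f s rest 0 (suc a) ≡ 0ℚ
  block-empty a with suc a ℕ.* weight s ≤ᵇ 0 | ℕₚ.≤ᵇ-reflects-≤ (suc a ℕ.* weight s) 0
  ... | true  | ofʸ ≤0 = contradiction (ℕₚ.≤-trans 1≤w (ℕₚ.≤-trans (ℕₚ.m≤m+n (weight s) (a ℕ.* weight s)) ≤0)) (λ ())
  ... | false | _      = refl
sumℚ-sp-byMultiplicity g (suc f) (suc n) s rest (suc M) 1≤w pos (s≤s n≤f) (s≤s n<M) = begin
  sumℚ (map g (sp (suc f) (suc n) (s ∷ rest)))
    ≡⟨ sumℚ-sp-∷ g f n s rest ⟩
  (if w ≤ᵇ suc n then sumℚ (map (g ∘ (s ∷_)) (sp f (suc n ∸ w) (s ∷ rest))) else 0ℚ) + block 0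
    ≡⟨ cong (_+ block 0) withS ⟩
  ∑ M (block ∘ suc) + block 0
    ≡⟨ ℚₚ.+-comm (∑ M (block ∘ suc)) (block 0) ⟩
  ∑ (suc M) block ∎
  where
  open ≡-Reasoning
  w : ℕ
  w = weight s
  block : ℕ → ℚ
  block = multiplicityBlock g (suc f) s rest (suc n)
  withS : (if w ≤ᵇ suc n then sumℚ (map (g ∘ (s ∷_)) (sp f (suc n ∸ w) (s ∷ rest))) else 0ℚ) ≡ ∑ M (block ∘ suc)
  withS with w ≤ᵇ suc n | ℕₚ.≤ᵇ-reflects-≤ w (suc n)
  ... | false | ofⁿ w≰ = sym (∑-zero M block-empty)
    where
    block-empty : ∀ a → block (suc a) ≡ 0ℚ
    block-empty a with w ℕ.+ a ℕ.* w ≤ᵇ suc n | ℕₚ.≤ᵇ-reflects-≤ (w ℕ.+ a ℕ.* w) (suc n)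
    ... | true  | ofʸ ≤ = contradiction (ℕₚ.≤-trans (ℕₚ.m≤m+n w (a ℕ.* w)) ≤) w≰
    ... | false | _     = refl
  ... | true  | ofʸ w≤ = trans
    (sumℚ-sp-byMultiplicity (g ∘ (s ∷_)) f (suc n ∸ w) s rest M 1≤w pos
       (ℕₚ.≤-trans (1+n∸w≤n n 1≤w) n≤f) (ℕₚ.≤-<-trans (1+n∸w≤n n 1≤w) n<M))
    (∑-cong M shift)
    where
    shift : ∀ a → multiplicityBlock (g ∘ (s ∷_)) f s rest (suc n ∸ w) a ≡ block (suc a)
    shift a with a ℕ.* w ≤ᵇ suc n ∸ w | ℕₚ.≤ᵇ-reflects-≤ (a ℕ.* w) (suc n ∸ w)
               | w ℕ.+ a ℕ.* w ≤ᵇ suc n | ℕₚ.≤ᵇ-reflects-≤ (w ℕ.+ a ℕ.* w) (suc n)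
    ... | true  | ofʸ _ | true  | ofʸ _  =
      cong (λ τs → sumℚ (map (λ τ → g (s ∷ replicate a s ++ τ)) τs))
           (trans (sp-fuel f (suc f) _ rest (ℕₚ.≤-trans (ℕₚ.m∸n≤m _ (a ℕ.* w)) (ℕₚ.≤-trans (1+n∸w≤n n 1≤w) n≤f))
                                            (ℕₚ.≤-trans (ℕₚ.m∸n≤m _ (a ℕ.* w)) (ℕₚ.≤-trans (1+n∸w≤n n 1≤w) (ℕₚ.m≤n⇒m≤1+n n≤f)))
                                            pos)
                  (cong (λ m → sp (suc f) m rest) (ℕₚ.∸-+-assoc (suc n) w (a ℕ.* w))))
    ... | true  | ofʸ ≤  | false | ofⁿ ≰ = contradiction (subst (w ℕ.+ a ℕ.* w ≤_) (ℕₚ.m+[n∸m]≡n w≤) (ℕₚ.+-monoʳ-≤ w ≤)) ≰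
    ... | false | ofⁿ ≰  | true  | ofʸ ≤ = contradiction (subst (_≤ suc n ∸ w) (ℕₚ.m+n∸m≡n w (a ℕ.* w)) (ℕₚ.∸-monoˡ-≤ w ≤)) ≰
    ... | false | _      | false | _     = refl

multiplicityBlock-fits : ∀ g f s rest n a → a ℕ.* weight s ≤ n →
  multiplicityBlock g f s rest n a ≡ sumℚ (map (λ τ → g (replicate a s ++ τ)) (sp f (n ∸ a ℕ.* weight s) rest))
multiplicityBlock-fits g f s rest n a aw≤n with a ℕ.* weight s ≤ᵇ n | ℕₚ.≤ᵇ-reflects-≤ (a ℕ.* weight s) n
... | true  | _       = refl
... | false | ofⁿ aw≰n = contradiction aw≤n aw≰n

multiplicityBlock-overflows : ∀ g f s rest n a → ¬ a ℕ.* weight s ≤ n → multiplicityBlock g f s rest n a ≡ 0ℚ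
multiplicityBlock-overflows g f s rest n a aw≰n with a ℕ.* weight s ≤ᵇ n | ℕₚ.≤ᵇ-reflects-≤ (a ℕ.* weight s) n
... | true  | ofʸ aw≤n = contradiction aw≤n aw≰n
... | false | _        = refl

-- Multinomial coefficients

open Counting ℕ._≟_ using () renaming
  (count-here to mult-here; count-there to mult-there; count-++ to mult-++; ∉⇒count≡0 to ∉⇒mult≡0)

mult-replicate : ∀ k a → mult k (replicate a k) ≡ a
mult-replicate k zero    = refl
mult-replicate k (suc a) = trans (mult-here k (replicate a k)) (cong suc (mult-replicate k a))

mult-replicate-≢ : ∀ {i k} a → i ≢ k → mult i (replicate a k) ≡ 0
mult-replicate-≢ zero    i≢k = refl
mult-replicate-≢ (suc a) i≢k = trans (mult-there _ i≢k) (mult-replicate-≢ a i≢k)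

∏! : ℕ → (ℕ → ℕ) → ℕ
∏! zero    h = 1
∏! (suc K) h = h 0 ! ℕ.* ∏! K (h ∘ suc)

prodFact-multiplicities : ∀ K xs → prodFact (multiplicities K xs) ≡ ∏! K (λ i → mult (suc i) xs)
prodFact-multiplicities K xs = go id K
  where
  go : ∀ (g : ℕ → ℕ) K → prodFact (map (λ i → mult (suc i) xs) (applyUpTo g K)) ≡ ∏! K (λ i → mult (suc (g i)) xs)
  go g zero    = refl
  go g (suc K) = cong (mult (suc (g 0)) xs ! ℕ.*_) (go (g ∘ suc) K)

∏!-cong< : ∀ K {h h' : ℕ → ℕ} → (∀ i → i < K → h i ≡ h' i) → ∏! K h ≡ ∏! K h'
∏!-cong< zero    eq = refl
∏!-cong< (suc K) eq = cong₂ (λ a b → a ! ℕ.* b) (eq 0 (s≤s z≤n)) (∏!-cong< K (λ i i<K → eq (suc i) (s≤s i<K)))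

∏!-extract : ∀ K c (h h' : ℕ → ℕ) → c < K → h' c ≡ 0 → (∀ i → i < K → i ≢ c → h i ≡ h' i) →
  ∏! K h ≡ h c ! ℕ.* ∏! K h'
∏!-extract (suc K) zero h h' _ h'0≡0 eq = cong (h 0 ! ℕ.*_) (begin
  ∏! K (h ∘ suc)                        ≡⟨ ∏!-cong< K (λ i i<K → eq (suc i) (s≤s i<K) (λ ())) ⟩
  ∏! K (h' ∘ suc)                       ≡⟨ ℕₚ.+-identityʳ _ ⟨
  0 ! ℕ.* ∏! K (h' ∘ suc)               ≡⟨ cong (λ z → z ! ℕ.* ∏! K (h' ∘ suc)) h'0≡0 ⟨
  h' 0 ! ℕ.* ∏! K (h' ∘ suc)            ∎)
  where open ≡-Reasoning
∏!-extract (suc K) (suc c) h h' (s≤s c<K) h'c≡0 eq = begin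
  h 0 ! ℕ.* ∏! K (h ∘ suc)
    ≡⟨ cong₂ ℕ._*_ (cong _! (eq 0 (s≤s z≤n) (λ ())))
                   (∏!-extract K c (h ∘ suc) (h' ∘ suc) c<K h'c≡0 (λ i i<K i≢c → eq (suc i) (s≤s i<K) (i≢c ∘ ℕₚ.suc-injective))) ⟩
  h' 0 ! ℕ.* (h (suc c) ! ℕ.* ∏! K (h' ∘ suc))
    ≡⟨ x*[y*z]≡y*[x*z] (h' 0 !) (h (suc c) !) (∏! K (h' ∘ suc)) ⟩
  h (suc c) ! ℕ.* (h' 0 ! ℕ.* ∏! K (h' ∘ suc)) ∎
  where open ≡-Reasoning

∏!-last : ∀ K h → ∏! (suc K) h ≡ ∏! K h ℕ.* h K !
∏!-last zero    h = trans (ℕₚ.*-identityʳ (h 0 !)) (sym (ℕₚ.+-identityʳ (h 0 !)))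
∏!-last (suc K) h = trans (cong (h 0 ! ℕ.*_) (∏!-last K (h ∘ suc))) (sym (ℕₚ.*-assoc (h 0 !) _ _))

InRange : ℕ → ℕ → Set
InRange K x = 1 ≤ x × x ≤ K

dropAll : ℕ → List ℕ → List ℕ
dropAll K = filterᵇ (λ x → not (K ≡ᵇ x))

module _ (K : ℕ) where

  dropAll-here : ∀ xs → dropAll K (K ∷ xs) ≡ dropAll K xs
  dropAll-here xs = Listₚ.filter-reject (T? ∘ (λ x → not (K ≡ᵇ x))) (subst (Bool.T ∘ not) (Dec.dec-true (K ℕ.≟ K) refl))

  dropAll-there : ∀ {x} xs → K ≢ x → dropAll K (x ∷ xs) ≡ x ∷ dropAll K xs
  dropAll-there {x} xs K≢x =
    Listₚ.filter-accept (T? ∘ (λ x → not (K ≡ᵇ x))) (subst (Bool.T ∘ not) (sym (Dec.dec-false (K ℕ.≟ x) K≢x)) _)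

  mult-dropAll : ∀ xs → mult K (dropAll K xs) ≡ 0
  mult-dropAll []       = refl
  mult-dropAll (x ∷ xs) with K ℕ.≟ x
  ... | yes refl = trans (cong (mult K) (dropAll-here xs)) (mult-dropAll xs)
  ... | no K≢x   = trans (cong (mult K) (dropAll-there xs K≢x)) (trans (mult-there _ K≢x) (mult-dropAll xs))

  mult-dropAll-≢ : ∀ {j} xs → j ≢ K → mult j (dropAll K xs) ≡ mult j xs
  mult-dropAll-≢     []       j≢K = refl
  mult-dropAll-≢ {j} (x ∷ xs) j≢K with K ℕ.≟ x | j ℕ.≟ x
  ... | yes refl | _        = trans (cong (mult j) (dropAll-here xs))
                                    (trans (mult-dropAll-≢ xs j≢K) (sym (mult-there xs j≢K)))
  ... | no K≢x   | yes refl = trans (cong (mult j) (dropAll-there xs K≢x))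
                                    (trans (mult-here j _) (trans (cong suc (mult-dropAll-≢ xs j≢K)) (sym (mult-here j xs))))
  ... | no K≢x   | no j≢x   = trans (cong (mult j) (dropAll-there xs K≢x))
                                    (trans (mult-there _ j≢x) (trans (mult-dropAll-≢ xs j≢K) (sym (mult-there xs j≢x))))

  length-dropAll : ∀ xs → length xs ≡ mult K xs ℕ.+ length (dropAll K xs)
  length-dropAll []       = refl
  length-dropAll (x ∷ xs) with K ℕ.≟ x
  ... | yes refl = trans (cong suc (length-dropAll xs))
                         (cong₂ (λ a l → a ℕ.+ length l) (sym (mult-here K xs)) (sym (dropAll-here xs)))
  ... | no K≢x   = trans (cong suc (length-dropAll xs))
                         (trans (sym (ℕₚ.+-suc (mult K xs) _))
                                (cong₂ (λ a l → a ℕ.+ length l) (sym (mult-there xs K≢x)) (sym (dropAll-there xs K≢x))))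

All-InRange-dropAll : ∀ K xs → All (InRange (suc K)) xs → All (InRange K) (dropAll (suc K) xs)
All-InRange-dropAll K []       []       = []
All-InRange-dropAll K (x ∷ xs) (r ∷ rs) with suc K ℕ.≟ x
... | yes refl = subst (All (InRange K)) (sym (dropAll-here (suc K) xs)) (All-InRange-dropAll K xs rs)
... | no K≢x   = subst (All (InRange K)) (sym (dropAll-there (suc K) xs K≢x))
                   ((proj₁ r , ℕₚ.≤-pred (ℕₚ.≤∧≢⇒< (proj₂ r) (K≢x ∘ sym))) ∷ All-InRange-dropAll K xs rs)

a!b!∣[a+b]! : ∀ a b → a ! ℕ.* b ! ∣ (a ℕ.+ b) !
a!b!∣[a+b]! a b = subst (λ z → a ! ℕ.* z ! ∣ (a ℕ.+ b) !) (ℕₚ.m+n∸m≡n a b) (k![n∸k]!∣n! (ℕₚ.m≤m+n a b))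

∏!-mult∣length! : ∀ K xs → All (InRange K) xs → ∏! K (λ i → mult (suc i) xs) ∣ length xs !
∏!-mult∣length! zero    []       []              = ∣-refl
∏!-mult∣length! zero    (x ∷ xs) ((1≤x , x≤0) ∷ _) = ⊥-elim (ℕₚ.<⇒≱ 1≤x x≤0)
∏!-mult∣length! (suc K) xs rs = subst₂ _∣_ (sym ∏!≡) (cong _! (sym (length-dropAll (suc K) xs)))
  (∣-trans (*-monoʳ-∣ (a !) (∏!-mult∣length! K xs′ (All-InRange-dropAll K xs rs))) (a!b!∣[a+b]! a (length xs′)))
  where
  xs′ : List ℕ
  xs′ = dropAll (suc K) xs
  a : ℕ
  a = mult (suc K) xs
  ∏!≡ : ∏! (suc K) (λ i → mult (suc i) xs) ≡ a ! ℕ.* ∏! K (λ i → mult (suc i) xs′)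
  ∏!≡ = trans (∏!-extract (suc K) K (λ i → mult (suc i) xs) (λ i → mult (suc i) xs′) (ℕₚ.n<1+n K) (mult-dropAll (suc K) xs)
                 (λ i i<K i≢K → sym (mult-dropAll-≢ (suc K) xs (i≢K ∘ ℕₚ.suc-injective))))
        (cong (a ! ℕ.*_) (trans (∏!-last K (λ i → mult (suc i) xs′))
                                (trans (cong (λ z → ∏! K (λ i → mult (suc i) xs′) ℕ.* z !) (mult-dropAll (suc K) xs))
                                       (ℕₚ.*-identityʳ (∏! K (λ i → mult (suc i) xs′))))))

[a+b]!≡C*a!*b! : ∀ a b → (a ℕ.+ b) ! ≡ ((a ℕ.+ b) C a) ℕ.* (a ! ℕ.* b !)
[a+b]!≡C*a!*b! a b = begin
  (a ℕ.+ b) !                                                 ≡⟨ DivMod.m/n*n≡m {{ℕₚ._!*_!≢0 a b}} (a!b!∣[a+b]! a b) ⟨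
  ((a ℕ.+ b) ! DivMod./ (a ! ℕ.* b !)) {{ℕₚ._!*_!≢0 a b}} ℕ.* (a ! ℕ.* b !)
    ≡⟨ cong (ℕ._* (a ! ℕ.* b !)) (trans (DivMod./-congʳ {{ℕₚ._!*_!≢0 a b}} {{_}} (cong (λ z → a ! ℕ.* z !) (sym (ℕₚ.m+n∸m≡n a b))))
                                         (sym (nCk≡n!/k![n-k]! (ℕₚ.m≤m+n a b)))) ⟩
  ((a ℕ.+ b) C a) ℕ.* (a ! ℕ.* b !)                           ∎
  where open ≡-Reasoning

multinomial-replicate : ∀ K c a xs → suc c ≤ K → All (InRange K) xs → mult (suc c) xs ≡ 0 →
  multinomial (a ℕ.+ length xs) (multiplicities K (replicate a (suc c) ++ xs))
    ≡ ((a ℕ.+ length xs) C a) ℕ.* multinomial (length xs) (multiplicities K xs)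
multinomial-replicate K c a xs c<K rs c∉xs = begin
  ((a ℕ.+ ℓ) ! DivMod./ prodFact ms) {{prodFact≢0 ms}}         ≡⟨ DivMod./-congʳ {{prodFact≢0 ms}} {{a!P′≢0}} prodFact-ms ⟩
  ((a ℕ.+ ℓ) ! DivMod./ (a ! ℕ.* P′)) {{a!P′≢0}}               ≡⟨ DivMod./-congˡ {{a!P′≢0}} [a+ℓ]!≡ ⟩
  (binom ℕ.* m′ ℕ.* (a ! ℕ.* P′) DivMod./ (a ! ℕ.* P′)) {{a!P′≢0}} ≡⟨ DivMod.m*n/n≡m (binom ℕ.* m′) (a ! ℕ.* P′) {{a!P′≢0}} ⟩
  binom ℕ.* m′                                                  ∎
  where
  open ≡-Reasoning
  ℓ : ℕ
  ℓ = length xs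
  ms : List ℕ
  ms = multiplicities K (replicate a (suc c) ++ xs)
  P′ : ℕ
  P′ = prodFact (multiplicities K xs)
  P′≢0 : NonZero P′
  P′≢0 = prodFact≢0 (multiplicities K xs)
  a!P′≢0 : NonZero (a ! ℕ.* P′)
  a!P′≢0 = ℕₚ.m*n≢0 (a !) P′ {{a ℕₚ.!≢0}} {{P′≢0}}
  binom : ℕ
  binom = (a ℕ.+ ℓ) C a
  m′ : ℕ
  m′ = multinomial ℓ (multiplicities K xs)
  prodFact-ms : prodFact ms ≡ a ! ℕ.* P′
  prodFact-ms = trans (prodFact-multiplicities K (replicate a (suc c) ++ xs))
    (trans (∏!-extract K c (λ i → mult (suc i) (replicate a (suc c) ++ xs)) (λ i → mult (suc i) xs) c<K c∉xs
              (λ i i<K i≢c → trans (mult-++ (suc i) (replicate a (suc c)) xs)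
                                   (cong (ℕ._+ mult (suc i) xs) (mult-replicate-≢ a (i≢c ∘ ℕₚ.suc-injective)))))
           (cong₂ (λ u v → u ! ℕ.* v)
                  (trans (mult-++ (suc c) (replicate a (suc c)) xs)
                         (trans (cong₂ ℕ._+_ (mult-replicate (suc c) a) c∉xs) (ℕₚ.+-identityʳ a)))
                  (sym (prodFact-multiplicities K xs))))
  P′*m′≡ℓ! : P′ ℕ.* m′ ≡ ℓ !
  P′*m′≡ℓ! = DivMod.m*[n/m]≡n {{P′≢0}} (subst (_∣ ℓ !) (sym (prodFact-multiplicities K xs)) (∏!-mult∣length! K xs rs))
  [a+ℓ]!≡ : (a ℕ.+ ℓ) ! ≡ binom ℕ.* m′ ℕ.* (a ! ℕ.* P′)
  [a+ℓ]!≡ = begin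
    (a ℕ.+ ℓ) !                         ≡⟨ [a+b]!≡C*a!*b! a ℓ ⟩
    binom ℕ.* (a ! ℕ.* ℓ !)             ≡⟨ cong (λ z → binom ℕ.* (a ! ℕ.* z)) P′*m′≡ℓ! ⟨
    binom ℕ.* (a ! ℕ.* (P′ ℕ.* m′))     ≡⟨ cong (binom ℕ.*_) (trans (cong (a ! ℕ.*_) (ℕₚ.*-comm P′ m′))
                                                                    (x*[y*z]≡y*[x*z] (a !) m′ P′)) ⟩
    binom ℕ.* (m′ ℕ.* (a ! ℕ.* P′))     ≡⟨ ℕₚ.*-assoc binom m′ _ ⟨
    binom ℕ.* m′ ℕ.* (a ! ℕ.* P′)       ∎

multinomial-[] : ∀ K → multinomial 0 (multiplicities K []) ≡ 1
multinomial-[] K = DivMod./-congʳ {{prodFact≢0 (multiplicities K [])}} {{_}}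
                                 (trans (prodFact-multiplicities K []) (∏!-ones K))
  where
  ∏!-ones : ∀ K → ∏! K (λ _ → 0) ≡ 1
  ∏!-ones zero    = refl
  ∏!-ones (suc K) = cong (1 ℕ.*_) (∏!-ones K)

-- The substitution x ↦ x^m

module SubstPow (k : ℕ) where

  m : ℕ
  m = suc k

  allDivisible : Mono → Bool
  allDivisible []              = true
  allDivisible ((i , j , e) ∷ μ) = (e % m ≡ᵇ 0) ∧ allDivisible μ

  divideExponents : Mono → Mono
  divideExponents []              = []
  divideExponents ((i , j , e) ∷ μ) = (i , j , e / m) ∷ divideExponents μ

  substPow-eval : ∀ F μ → substPow m F μ ≡ gate (allDivisible μ) (F (divideExponents μ))
  substPow-eval F []              = refl
  substPow-eval F ((i , j , e) ∷ μ) with e % m ≡ᵇ 0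
  ... | true  = substPow-eval (curryS F (i , j , e / m)) μ
  ... | false = refl

  substPow-cong-Valid : ∀ {F G} → (∀ μ → Valid μ → F μ ≡ G μ) → ∀ μ → Valid μ → substPow m F μ ≡ substPow m G μ
  substPow-cong-Valid {F} {G} F≈G μ v =
    trans (substPow-eval F μ) (trans (cong (gate (allDivisible μ)) (F≈G _ (divide-Valid μ v))) (sym (substPow-eval G μ)))
    where
    divide-Valid : ∀ μ → Valid μ → Valid (divideExponents μ)
    divide-Valid []              []       = []
    divide-Valid ((i , j , e) ∷ μ) (1≤i ∷ v) = 1≤i ∷ divide-Valid μ v

  substPow-oneS : substPow m oneS ≗ oneS
  substPow-oneS []                    = refl
  substPow-oneS ((i , j , zero) ∷ μ)  = substPow-oneS μ
  substPow-oneS ((i , j , suc e) ∷ μ) with suc e % m ℕ.≟ 0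
  ... | no  m∤ = trans (substPow-eval oneS ((i , j , suc e) ∷ μ))
                       (cong (λ b → gate (b ∧ allDivisible μ) (oneS (divideExponents ((i , j , suc e) ∷ μ))))
                             (Dec.dec-false (suc e % m ℕ.≟ 0) m∤))
  ... | yes m∣ = trans (substPow-eval oneS ((i , j , suc e) ∷ μ))
                       (trans (cong (gate b) (oneS-nonzeroExponent (suc e / m) quotient≢0)) (gate-0ℚ b))
    where
    b : Bool
    b = allDivisible ((i , j , suc e) ∷ μ)
    quotient≢0 : suc e / m ≢ 0
    quotient≢0 q≡0 = ℕₚ.1+n≢0 (trans (sym (DivMod.m/n*n≡m (m%n≡0⇒n∣m (suc e) m m∣))) (cong (ℕ._* m) q≡0))
    oneS-nonzeroExponent : ∀ q → q ≢ 0 → oneS ((i , j , q) ∷ divideExponents μ) ≡ 0ℚ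
    oneS-nonzeroExponent zero    q≢0 = ⊥-elim (q≢0 refl)
    oneS-nonzeroExponent (suc q) _   = refl

  substPow-⊕ : ∀ F G → substPow m (F ⊕ G) ≗ (substPow m F ⊕ substPow m G)
  substPow-⊕ F G μ = trans (substPow-eval (F ⊕ G) μ)
    (sym (trans (cong₂ _+_ (substPow-eval F μ) (substPow-eval G μ)) (gate-+ (allDivisible μ))))
    where
    gate-+ : ∀ b → gate b (F (divideExponents μ)) + gate b (G (divideExponents μ)) ≡ gate b ((F ⊕ G) (divideExponents μ))
    gate-+ true  = refl
    gate-+ false = ℚₚ.+-identityˡ 0ℚ

  substPow-· : ∀ c F → substPow m (c · F) ≗ (c · substPow m F)
  substPow-· c F μ = trans (substPow-eval (c · F) μ)
    (sym (trans (cong (c *_) (substPow-eval F μ)) (gate-* (allDivisible μ))))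
    where
    gate-* : ∀ b → c * gate b (F (divideExponents μ)) ≡ gate b (c * F (divideExponents μ))
    gate-* true  = refl
    gate-* false = ℚₚ.*-zeroʳ c

  ∑-multiples : ∀ q (h : ℕ → ℚ) → (∀ a → a % m ≢ 0 → h a ≡ 0ℚ) → ∑ (suc (q ℕ.* m)) h ≡ ∑ (suc q) (λ b → h (b ℕ.* m))
  ∑-multiples zero    h h≡0 = refl
  ∑-multiples (suc q) h h≡0 = begin
    ∑ (suc (m ℕ.+ q ℕ.* m)) h                                 ≡⟨ cong (λ n → ∑ (suc n) h) (ℕₚ.+-comm m (q ℕ.* m)) ⟩
    ∑ (suc (q ℕ.* m) ℕ.+ m) h                                 ≡⟨ ∑-++ (suc (q ℕ.* m)) m h ⟩
    ∑ (suc (q ℕ.* m)) h + ∑ m (λ i → h (suc (q ℕ.* m) ℕ.+ i)) ≡⟨ cong₂ _+_ (∑-multiples q h h≡0) next-multiple ⟩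
    ∑ (suc q) (λ b → h (b ℕ.* m)) + h (suc q ℕ.* m)           ≡⟨ ∑-last (suc q) (λ b → h (b ℕ.* m)) ⟨
    ∑ (suc (suc q)) (λ b → h (b ℕ.* m))                       ∎
    where
    open ≡-Reasoning
    not-multiple : ∀ i → i < m → i ≢ k → (suc (q ℕ.* m) ℕ.+ i) % m ≢ 0
    not-multiple i i<m i≢k rem≡0 = ℕₚ.0≢1+n (sym (begin
      suc i                           ≡⟨ DivMod.m<n⇒m%n≡m (s≤s (ℕₚ.≤∧≢⇒< (ℕₚ.≤-pred i<m) i≢k)) ⟨
      suc i % m                       ≡⟨ DivMod.[m+kn]%n≡m%n (suc i) q m ⟨
      (suc i ℕ.+ q ℕ.* m) % m         ≡⟨ cong (_% m) (trans (ℕₚ.+-comm (suc i) (q ℕ.* m)) (ℕₚ.+-suc (q ℕ.* m) i)) ⟩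
      (suc (q ℕ.* m) ℕ.+ i) % m       ≡⟨ rem≡0 ⟩
      0                               ∎))
    next-multiple : ∑ m (λ i → h (suc (q ℕ.* m) ℕ.+ i)) ≡ h (suc q ℕ.* m)
    next-multiple = trans (∑-single m k _ (ℕₚ.n<1+n k) (λ i i<m i≢k → h≡0 (suc (q ℕ.* m) ℕ.+ i) (not-multiple i i<m i≢k)))
                          (cong h (trans (sym (ℕₚ.+-suc (q ℕ.* m) k)) (ℕₚ.+-comm (q ℕ.* m) m)))

  curryS-substPow : ∀ F i j a → curryS (substPow m F) (i , j , a) ≗ (λ ν → gate (a % m ≡ᵇ 0) (substPow m (curryS F (i , j , a / m)) ν))
  curryS-substPow F i j a ν with a % m ≡ᵇ 0
  ... | true  = refl
  ... | false = refl

  ⊗-gate : ∀ b₁ b₂ {X Y X′ Y′} → X ≗ (gate b₁ ∘ X′) → Y ≗ (gate b₂ ∘ Y′) → (X ⊗ Y) ≗ (gate (b₁ ∧ b₂) ∘ (X′ ⊗ Y′))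
  ⊗-gate true  true  {X} {Y} {X′} {Y′} X≗ Y≗ μ = trans (⊗-congˡ Y X≗ μ) (⊗-congʳ X′ Y≗ μ)
  ⊗-gate true  false {X} {Y} {X′} {Y′} X≗ Y≗ μ = trans (⊗-congʳ X Y≗ μ) (⊗-zeroʳ X μ)
  ⊗-gate false b₂    {X} {Y} {X′} {Y′} X≗ Y≗ μ = trans (⊗-congˡ Y X≗ μ) (⊗-zeroˡ Y μ)

  splitTerm : ℕ → (ℕ → ℕ → ℚ) → ℕ → ℚ
  splitTerm e φ a = gate ((a % m ≡ᵇ 0) ∧ ((e ∸ a) % m ≡ᵇ 0)) (φ (a / m) ((e ∸ a) / m))

  splitTerm-off : ∀ e φ a → a % m ≢ 0 → splitTerm e φ a ≡ 0ℚ
  splitTerm-off e φ a m∤a =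
    cong (λ b → gate (b ∧ ((e ∸ a) % m ≡ᵇ 0)) (φ (a / m) ((e ∸ a) / m))) (Dec.dec-false (a % m ℕ.≟ 0) m∤a)

  ∑-divisibleSplits : ∀ e (φ : ℕ → ℕ → ℚ) →
    ∑ (suc e) (λ a → gate ((a % m ≡ᵇ 0) ∧ ((e ∸ a) % m ≡ᵇ 0)) (φ (a / m) ((e ∸ a) / m)))
      ≡ gate (e % m ≡ᵇ 0) (∑ (suc (e / m)) (λ b → φ b (e / m ∸ b)))
  ∑-divisibleSplits e φ with e % m ℕ.≟ 0
  ... | no m∤e = trans (∑-zero< (suc e) (λ a a≤e → h≡0 a (ℕₚ.≤-pred a≤e)))
                       (sym (cong (λ b → gate b (∑ (suc (e / m)) (λ b → φ b (e / m ∸ b)))) (Dec.dec-false (e % m ℕ.≟ 0) m∤e)))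
    where
    h≡0 : ∀ a → a ≤ e → splitTerm e φ a ≡ 0ℚ
    h≡0 a a≤e with a % m ℕ.≟ 0 | (e ∸ a) % m ℕ.≟ 0
    ... | no m∤a  | _         = splitTerm-off e φ a m∤a
    ... | yes m∣a | no m∤e∸a  = cong₂ (λ b₁ b₂ → gate (b₁ ∧ b₂) (φ (a / m) ((e ∸ a) / m)))
                                      (Dec.dec-true (a % m ℕ.≟ 0) m∣a) (Dec.dec-false ((e ∸ a) % m ℕ.≟ 0) m∤e∸a)
    ... | yes m∣a | yes m∣e∸a = contradiction (n∣m⇒m%n≡0 e m (subst (m ∣_) (ℕₚ.m+[n∸m]≡n a≤e)
                                   (∣m∣n⇒∣m+n (m%n≡0⇒n∣m a m m∣a) (m%n≡0⇒n∣m (e ∸ a) m m∣e∸a)))) m∤e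
  ... | yes m∣e = begin
    ∑ (suc e) (splitTerm e φ)                           ≡⟨ cong (λ n → ∑ (suc n) (splitTerm e φ)) e≡q*m ⟩
    ∑ (suc (q ℕ.* m)) (splitTerm e φ)                   ≡⟨ ∑-multiples q (splitTerm e φ) (splitTerm-off e φ) ⟩
    ∑ (suc q) (λ b → splitTerm e φ (b ℕ.* m))         ≡⟨ ∑-cong (suc q) h-multiple ⟩
    ∑ (suc q) (λ b → φ b (q ∸ b))         ≡⟨ cong (λ b → gate b (∑ (suc q) (λ b → φ b (q ∸ b)))) (Dec.dec-true (e % m ℕ.≟ 0) m∣e) ⟨
    gate (e % m ≡ᵇ 0) (∑ (suc q) (λ b → φ b (q ∸ b))) ∎
    where
    open ≡-Reasoning
    q : ℕ
    q = e / m
    e≡q*m : e ≡ q ℕ.* m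
    e≡q*m = sym (DivMod.m/n*n≡m (m%n≡0⇒n∣m e m m∣e))
    h-multiple : ∀ b → splitTerm e φ (b ℕ.* m) ≡ φ b (q ∸ b)
    h-multiple b = trans
      (cong₂ (λ b₁ b₂ → gate (b₁ ∧ b₂) (φ (b ℕ.* m / m) ((e ∸ b ℕ.* m) / m)))
             (cong (_≡ᵇ 0) (DivMod.m*n%n≡0 b m)) (cong (_≡ᵇ 0) (trans (cong (_% m) e∸bm≡) (DivMod.m*n%n≡0 (q ∸ b) m))))
      (cong₂ φ (DivMod.m*n/n≡m b m) (trans (cong (_/ m) e∸bm≡) (DivMod.m*n/n≡m (q ∸ b) m)))
      where
      e∸bm≡ : e ∸ b ℕ.* m ≡ (q ∸ b) ℕ.* m
      e∸bm≡ = trans (cong (_∸ b ℕ.* m) e≡q*m) (sym (ℕₚ.*-distribʳ-∸ m q b))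

  substPow-⊗ : ∀ F G → substPow m (F ⊗ G) ≗ (substPow m F ⊗ substPow m G)
  substPow-⊗ F G []                = trans (⊗-[] F G) (sym (⊗-[] (substPow m F) (substPow m G)))
  substPow-⊗ F G ((i , j , e) ∷ μ) = sym (begin
    (substPow m F ⊗ substPow m G) ((i , j , e) ∷ μ)
      ≡⟨ ⊗-∷ (substPow m F) (substPow m G) i j e μ ⟩
    ∑ (suc e) (λ a → (curryS (substPow m F) (i , j , a) ⊗ curryS (substPow m G) (i , j , e ∸ a)) μ)
      ≡⟨ ∑-cong (suc e) term ⟩
    ∑ (suc e) (λ a → gate ((a % m ≡ᵇ 0) ∧ ((e ∸ a) % m ≡ᵇ 0)) (substPow m (F′ (a / m) ⊗ G′ ((e ∸ a) / m)) μ))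
      ≡⟨ ∑-divisibleSplits e (λ b c → substPow m (F′ b ⊗ G′ c) μ) ⟩
    gate (e % m ≡ᵇ 0) (∑ (suc q) (λ b → substPow m (F′ b ⊗ G′ (q ∸ b)) μ))
      ≡⟨ cong (gate (e % m ≡ᵇ 0)) (trans (∑-cong (suc q) (λ b → substPow-eval (F′ b ⊗ G′ (q ∸ b)) μ))
                                        (sym (gate-∑ (allDivisible μ) (suc q) (λ b → (F′ b ⊗ G′ (q ∸ b)) ν)))) ⟩
    gate (e % m ≡ᵇ 0) (gate (allDivisible μ) (∑ (suc q) (λ b → (F′ b ⊗ G′ (q ∸ b)) ν)))
      ≡⟨ cong (gate (e % m ≡ᵇ 0) ∘ gate (allDivisible μ)) (⊗-∷ F G i j q ν) ⟨
    gate (e % m ≡ᵇ 0) (gate (allDivisible μ) ((F ⊗ G) ((i , j , q) ∷ ν)))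
      ≡⟨ gate-∧ (e % m ≡ᵇ 0) (allDivisible μ) ((F ⊗ G) ((i , j , q) ∷ ν)) ⟩
    gate ((e % m ≡ᵇ 0) ∧ allDivisible μ) ((F ⊗ G) ((i , j , q) ∷ ν))
      ≡⟨ substPow-eval (F ⊗ G) ((i , j , e) ∷ μ) ⟨
    substPow m (F ⊗ G) ((i , j , e) ∷ μ) ∎)
    where
    open ≡-Reasoning
    q : ℕ
    q = e / m
    ν : Mono
    ν = divideExponents μ
    F′ G′ : ℕ → Series
    F′ a = curryS F (i , j , a)
    G′ a = curryS G (i , j , a)
    term : ∀ a → (curryS (substPow m F) (i , j , a) ⊗ curryS (substPow m G) (i , j , e ∸ a)) μ
                 ≡ gate ((a % m ≡ᵇ 0) ∧ ((e ∸ a) % m ≡ᵇ 0)) (substPow m (F′ (a / m) ⊗ G′ ((e ∸ a) / m)) μ)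
    term a = trans (⊗-gate (a % m ≡ᵇ 0) ((e ∸ a) % m ≡ᵇ 0) (curryS-substPow F i j a) (curryS-substPow G i j (e ∸ a)) μ)
                   (cong (gate _) (sym (substPow-⊗ (F′ (a / m)) (G′ ((e ∸ a) / m)) μ)))

  substPow-prodS : ∀ Fs → substPow m (prodS Fs) ≗ prodS (map (substPow m) Fs)
  substPow-prodS []       = substPow-oneS
  substPow-prodS (F ∷ Fs) μ = trans (substPow-⊗ F (prodS Fs) μ) (⊗-congʳ (substPow m F) (substPow-prodS Fs) μ)

-- H, E and P as homogeneous parts

homPart : ℕ → Series → Series
homPart n F μ = gate (degree μ ≡ᵇ n) (F μ)

homPart-homogeneous : ∀ n F → Homogeneous n (homPart n F)
homPart-homogeneous n F μ deg≢n = cong (λ b → gate b (F μ)) (Dec.dec-false (degree μ ℕ.≟ n) deg≢n)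

homPart-≡ : ∀ n F μ → degree μ ≡ n → homPart n F μ ≡ F μ
homPart-≡ n F μ deg≡n = cong (λ b → gate b (F μ)) (Dec.dec-true (degree μ ℕ.≟ n) deg≡n)

homPart-intro : ∀ n G μ {x} → (degree μ ≡ n → x ≡ G μ) → (degree μ ≢ n → x ≡ 0ℚ) → x ≡ homPart n G μ
homPart-intro n G μ on off with degree μ ℕ.≟ n
... | yes deg≡n = trans (on deg≡n) (sym (homPart-≡ n G μ deg≡n))
... | no  deg≢n = trans (off deg≢n) (sym (homPart-homogeneous n G μ deg≢n))

PositiveStack : Stack → Set
PositiveStack (d , m) = 1 ≤ d × 1 ≤ m

monoType-positive : ∀ μ → Valid μ → All PositiveStack (monoType μ)
monoType-positive []                    []        = []
monoType-positive ((i , j , zero) ∷ μ)  (_ ∷ v)   = monoType-positive μ v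
monoType-positive ((i , j , suc e) ∷ μ) (1≤i ∷ v) = (1≤i , s≤s z≤n) ∷ monoType-positive μ v

sumBy-weight-monoType : ∀ μ → sumBy weight (monoType μ) ≡ degree μ
sumBy-weight-monoType []                    = refl
sumBy-weight-monoType ((i , j , zero) ∷ μ)  = trans (sumBy-weight-monoType μ) (cong (ℕ._+ degree μ) (sym (ℕₚ.*-zeroʳ i)))
sumBy-weight-monoType ((i , j , suc e) ∷ μ) = cong (i ℕ.* suc e ℕ.+_) (sumBy-weight-monoType μ)

weight≤sumBy : ∀ T → All (λ t → weight t ≤ sumBy weight T) T
weight≤sumBy []      = []
weight≤sumBy (t ∷ T) = ℕₚ.m≤m+n (weight t) (sumBy weight T)
                     ∷ All.map (λ le → ℕₚ.≤-trans le (ℕₚ.m≤n+m (sumBy weight T) (weight t))) (weight≤sumBy T)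

monoType-⊆ : ∀ {c n} μ → Valid μ → degree μ ≡ n → (∀ {t} → PositiveStack t → weight t ≤ n → t ∈ c) →
  All (_∈ c) (monoType μ)
monoType-⊆ {c} {n} μ v deg≡n ∈c = All.zipWith (λ (pos , le) → ∈c pos (ℕₚ.≤-trans le (ℕₚ.≤-reflexive weight≡n)))
                                              (monoType-positive μ v , weight≤sumBy (monoType μ))
  where
  weight≡n : sumBy weight (monoType μ) ≡ n
  weight≡n = trans (sumBy-weight-monoType μ) deg≡n

M-matchCount : ∀ μ τs → sumS (map M τs) μ ≡ matchCount (monoType μ) τs
M-matchCount μ []       = refl
M-matchCount μ (τ ∷ τs) = cong (M τ μ +_) (M-matchCount μ τs)

stacksUpTo≡ : ∀ n → stacksUpTo n ≡ cartesianProductWith (λ d m → (suc d , suc m)) (upTo n) (upTo n)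
stacksUpTo≡ n = go (upTo n)
  where
  go : ∀ ds → concatMap (λ d → map (λ m → (suc d , suc m)) (upTo n)) ds
              ≡ cartesianProductWith (λ d m → (suc d , suc m)) ds (upTo n)
  go []       = refl
  go (d ∷ ds) = cong (map (λ m → (suc d , suc m)) (upTo n) ++_) (go ds)

stacksUpTo-unique : ∀ n → Unique (stacksUpTo n)
stacksUpTo-unique n rewrite stacksUpTo≡ n =
  Uniqueₚ.cartesianProductWith⁺ _ (λ { refl → refl , refl }) (Uniqueₚ.upTo⁺ n) (Uniqueₚ.upTo⁺ n)

stacksUpTo-positive : ∀ n → PositiveWeights (stacksUpTo n)
stacksUpTo-positive n rewrite stacksUpTo≡ n = All.tabulate (λ t∈ → positive (∈ₚ.∈-cartesianProductWith⁻ _ (upTo n) (upTo n) t∈))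
  where
  positive : ∀ {t} → ∃ (λ a → ∃ (λ b → a ∈ upTo n × b ∈ upTo n × t ≡ (suc a , suc b))) → 1 ≤ weight t
  positive (a , b , _ , _ , refl) = s≤s z≤n

∈-stacksUpTo : ∀ n {t} → PositiveStack t → weight t ≤ n → t ∈ stacksUpTo n
∈-stacksUpTo n {suc a , suc b} _ weight≤n rewrite stacksUpTo≡ n =
  ∈ₚ.∈-cartesianProductWith⁺ _
    (∈ₚ.∈-upTo⁺ (ℕₚ.≤-trans (s≤s (ℕₚ.≤-trans (ℕₚ.m≤m*n a (suc b)) (ℕₚ.m≤n+m (a ℕ.* suc b) b))) weight≤n))
    (∈ₚ.∈-upTo⁺ (ℕₚ.≤-trans (s≤s (ℕₚ.m≤m+n b (a ℕ.* suc b))) weight≤n))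

H-homPart : ∀ n μ → Valid μ → H n μ ≡ homPart n Hgen μ
H-homPart n μ v with degree μ ℕ.≟ n
... | yes deg≡n = trans (M-matchCount μ (stackPartitions n))
  (trans (matchCount-exactlyOne n n (stacksUpTo n) (monoType μ) ℕₚ.≤-refl (stacksUpTo-positive n) (stacksUpTo-unique n)
            (monoType-⊆ μ v deg≡n (∈-stacksUpTo n)) (trans (sumBy-weight-monoType μ) deg≡n))
         (sym (homPart-≡ n Hgen μ deg≡n)))
... | no deg≢n = trans (M-matchCount μ (stackPartitions n))
  (trans (matchCount-wrongWeight n n (stacksUpTo n) (monoType μ) (deg≢n ∘ trans (sym (sumBy-weight-monoType μ))))
         (sym (homPart-homogeneous n Hgen μ deg≢n)))

sumS-eval : ∀ Fs μ → sumS Fs μ ≡ sumℚ (map (λ F → F μ) Fs)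
sumS-eval []       μ = refl
sumS-eval (F ∷ Fs) μ = cong (F μ +_) (sumS-eval Fs μ)

UnitStack : ℕ → Stack → Set
UnitStack d (i , e) = e ≡ 1 × 1 ≤ i × i ≤ d

unitStacks : ℕ → List Stack
unitStacks zero    = []
unitStacks (suc d) = (suc d , 1) ∷ unitStacks d

partitions≡ : ∀ d → partitions d ≡ map (map proj₁) (sp d d (unitStacks d))
partitions≡ d = cong (λ c → map (map proj₁) (sp d d c))
                     (trans (cong (map (λ k → (k , 1))) (Listₚ.reverse-applyUpTo suc d)) (downFrom d))
  where
  downFrom : ∀ d → map (λ k → (k , 1)) (applyDownFrom suc d) ≡ unitStacks d
  downFrom zero    = refl
  downFrom (suc d) = cong ((suc d , 1) ∷_) (downFrom d)

unitStacks-unit : ∀ d → All (UnitStack d) (unitStacks d)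
unitStacks-unit zero    = []
unitStacks-unit (suc d) = (refl , s≤s z≤n , ℕₚ.≤-refl)
                        ∷ All.map (λ (e≡1 , 1≤i , i≤d) → e≡1 , 1≤i , ℕₚ.m≤n⇒m≤1+n i≤d) (unitStacks-unit d)

unitStacks-positive : ∀ d → PositiveWeights (unitStacks d)
unitStacks-positive d = All.map (λ { {i , .1} (refl , 1≤i , _) → subst (1 ≤_) (sym (ℕₚ.*-identityʳ i)) 1≤i })
                                (unitStacks-unit d)

unitStacks-unique : ∀ d → Unique (unitStacks d)
unitStacks-unique zero    = []
unitStacks-unique (suc d) = All.map (λ (_ , _ , i≤d) eq → ℕₚ.<⇒≱ (s≤s ℕₚ.≤-refl) (subst (_≤ d) (sym (cong proj₁ eq)) i≤d))
                                    (unitStacks-unit d)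
                          ∷ unitStacks-unique d

∈-unitStacks : ∀ d {i} → 1 ≤ i → i ≤ d → (i , 1) ∈ unitStacks d
∈-unitStacks zero    1≤i i≤0 = ⊥-elim (ℕₚ.<⇒≱ 1≤i i≤0)
∈-unitStacks (suc d) {i} 1≤i i≤1+d with i ℕ.≟ suc d
... | yes refl = here refl
... | no i≢1+d = there (∈-unitStacks d 1≤i (ℕₚ.≤-pred (ℕₚ.≤∧≢⇒< i≤1+d i≢1+d)))

Egen-squarefree : ∀ μ → All (λ t → proj₂ t ≡ 1) (monoType μ) → Egen μ ≡ sign (length (monoType μ))
Egen-squarefree []                          _            = refl
Egen-squarefree ((i , j , zero) ∷ μ)        sqf          = trans (ℚₚ.*-identityˡ (Egen μ)) (Egen-squarefree μ sqf)
Egen-squarefree ((i , j , suc zero) ∷ μ)    (_ ∷ sqf)    = trans (cong (- 1ℚ *_) (Egen-squarefree μ sqf))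
                                                                  (solve 1 (λ p → (:- con 1ℚ) :* p := :- p) refl _)
Egen-squarefree ((i , j , suc (suc e)) ∷ μ) (() ∷ _)

Egen-nonsquarefree : ∀ μ {t} → t ∈ monoType μ → proj₂ t ≢ 1 → Egen μ ≡ 0ℚ
Egen-nonsquarefree ((i , j , zero) ∷ μ)        t∈ e≢1        = trans (ℚₚ.*-identityˡ (Egen μ)) (Egen-nonsquarefree μ t∈ e≢1)
Egen-nonsquarefree ((i , j , suc zero) ∷ μ)    (here refl) e≢1 = ⊥-elim (e≢1 refl)
Egen-nonsquarefree ((i , j , suc zero) ∷ μ)    (there t∈) e≢1 = trans (cong (- 1ℚ *_) (Egen-nonsquarefree μ t∈ e≢1)) (ℚₚ.*-zeroʳ (- 1ℚ))
Egen-nonsquarefree ((i , j , suc (suc e)) ∷ μ) _          _   = ℚₚ.*-zeroˡ (Egen μ)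

sumS-partitions : ∀ d (F : List ℕ → Series) μ →
  sumS (map F (partitions d)) μ ≡ sumℚ (map (λ τ → F (map proj₁ τ) μ) (sp d d (unitStacks d)))
sumS-partitions d F μ = begin
  sumS (map F (partitions d)) μ                                     ≡⟨ sumS-eval (map F (partitions d)) μ ⟩
  sumℚ (map (λ G → G μ) (map F (partitions d)))                     ≡⟨ sumℚ-map-map (λ G → G μ) F (partitions d) ⟩
  sumℚ (map (λ λ′ → F λ′ μ) (partitions d))                         ≡⟨ cong (sumℚ ∘ map (λ λ′ → F λ′ μ)) (partitions≡ d) ⟩
  sumℚ (map (λ λ′ → F λ′ μ) (map (map proj₁) (sp d d (unitStacks d))))
                                                                    ≡⟨ sumℚ-map-map (λ λ′ → F λ′ μ) (map proj₁) (sp d d (unitStacks d)) ⟩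
  sumℚ (map (λ τ → F (map proj₁ τ) μ) (sp d d (unitStacks d)))      ∎
  where open ≡-Reasoning

E-matchCount : ∀ d μ → E d μ ≡ sign (length (monoType μ)) * matchCount (monoType μ) (sp d d (unitStacks d))
E-matchCount d μ = begin
  E d μ
    ≡⟨ sumS-partitions d (λ α → sign (length α) · M (asStacks α)) μ ⟩
  sumℚ (map (λ τ → sign (length (map proj₁ τ)) * M (asStacks (map proj₁ τ)) μ) (sp d d (unitStacks d)))
    ≡⟨ sumℚ-congAll (All.map (λ {τ} → matching-term τ) (sp-All d d (unitStacks d) (unitStacks-unit d))) ⟩
  sumℚ (map (λ τ → sign (length T) * indicator (sameMultiset T τ)) (sp d d (unitStacks d)))
    ≡⟨ sumℚ-*ˡ (sign (length T)) (λ τ → indicator (sameMultiset T τ)) (sp d d (unitStacks d)) ⟨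
  sign (length T) * matchCount T (sp d d (unitStacks d)) ∎
  where
  open ≡-Reasoning
  T : List Stack
  T = monoType μ
  asStacks-proj₁ : ∀ τ → All (UnitStack d) τ → asStacks (map proj₁ τ) ≡ τ
  asStacks-proj₁ []             []                = refl
  asStacks-proj₁ ((i , .1) ∷ τ) ((refl , _) ∷ us) = cong ((i , 1) ∷_) (asStacks-proj₁ τ us)
  matching-term : ∀ τ → All (UnitStack d) τ →
    sign (length (map proj₁ τ)) * M (asStacks (map proj₁ τ)) μ ≡ sign (length T) * indicator (sameMultiset T τ)
  matching-term τ units rewrite Listₚ.length-map proj₁ τ | asStacks-proj₁ τ units
    with sameMultiset T τ | sameMultiset-reflects T τ
  ... | true  | ofʸ T≋τ = cong (λ ℓ → sign ℓ * 1ℚ) (sym (≋⇒length≡ T τ T≋τ))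
  ... | false | _       = trans (ℚₚ.*-zeroʳ (sign (length τ))) (sym (ℚₚ.*-zeroʳ (sign (length T))))

E-homPart : ∀ d μ → Valid μ → E d μ ≡ homPart d Egen μ
E-homPart d μ v with degree μ ℕ.≟ d
... | no deg≢d = trans (E-matchCount d μ)
  (trans (cong (sign (length T) *_) (matchCount-wrongWeight d d (unitStacks d) T (deg≢d ∘ trans (sym (sumBy-weight-monoType μ)))))
         (trans (ℚₚ.*-zeroʳ (sign (length T))) (sym (homPart-homogeneous d Egen μ deg≢d))))
  where
  T : List Stack
  T = monoType μ
... | yes deg≡d = trans (E-matchCount d μ) (trans squarefree-or-not (sym (homPart-≡ d Egen μ deg≡d)))
  where
  T : List Stack
  T = monoType μ
  squarefree-or-not : sign (length T) * matchCount T (sp d d (unitStacks d)) ≡ Egen μ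
  squarefree-or-not with All.all? (λ t → proj₂ t ℕ.≟ 1) T
  ... | yes sqf = trans (cong (sign (length T) *_) (matchCount-exactlyOne d d (unitStacks d) T ℕₚ.≤-refl
                          (unitStacks-positive d) (unitStacks-unique d) T⊆units (trans (sumBy-weight-monoType μ) deg≡d)))
                        (trans (ℚₚ.*-identityʳ _) (sym (Egen-squarefree μ sqf)))
    where
    T⊆units : All (_∈ unitStacks d) T
    T⊆units = All.zipWith (λ { {i , .1} (((1≤i , _) , i*1≤d) , refl) →
                                 ∈-unitStacks d 1≤i (subst (_≤ d) (ℕₚ.*-identityʳ i) i*1≤d) })
                          (All.zipWith id (monoType-positive μ v , All.map (λ le → ℕₚ.≤-trans le
                             (ℕₚ.≤-reflexive (trans (sumBy-weight-monoType μ) deg≡d))) (weight≤sumBy T)) , sqf)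
  ... | no ¬sqf with find (Allₚ.¬All⇒Any¬ (λ t → proj₂ t ℕ.≟ 1) T ¬sqf)
  ...   | (t , t∈T , e≢1) = trans (cong (sign (length T) *_) (matchCount-foreign d d (unitStacks d) T t∈T
                                    (λ t∈units → e≢1 (proj₁ (All.lookup (unitStacks-unit d) t∈units)))))
                                  (trans (ℚₚ.*-zeroʳ (sign (length T))) (sym (Egen-nonsquarefree μ t∈T e≢1)))

pgen : List Stack → ℚ
pgen ((i , e) ∷ []) = ℕtoℚ i
pgen _              = 0ℚ

Pgen-monoType : ∀ μ → Pgen μ ≡ pgen (monoType μ)
Pgen-monoType []                    = refl
Pgen-monoType ((i , j , zero) ∷ μ)  = Pgen-monoType μ
Pgen-monoType ((i , j , suc e) ∷ μ) = trans (cong (ℕtoℚ i *_) (oneS-monoType μ)) (single (monoType μ))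
  where
  oneS-monoType : ∀ μ → oneS μ ≡ indicator (null (monoType μ))
  oneS-monoType []                    = refl
  oneS-monoType ((i , j , zero) ∷ μ)  = oneS-monoType μ
  oneS-monoType ((i , j , suc e) ∷ μ) = refl
  single : ∀ T → ℕtoℚ i * indicator (null T) ≡ pgen ((i , suc e) ∷ T)
  single []      = ℚₚ.*-identityʳ (ℕtoℚ i)
  single (_ ∷ _) = ℚₚ.*-zeroʳ (ℕtoℚ i)

-- Unlike `gate (does a?)`, this does not reduce past a?, so `with suc k ∣? d` can abstract over it.
gateDec : ∀ {A : Set} → Dec A → ℚ → ℚ
gateDec (yes _) x = x
gateDec (no _)  _ = 0ℚ

P-term : ℕ → List Stack → ℕ → ℚ
P-term d T k = gateDec (suc k ∣? d) (ℕtoℚ (suc k) * indicator (sameMultiset T ((suc k , d / suc k) ∷ [])))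

P-∑ : ∀ d μ → P d μ ≡ ∑ d (P-term d (monoType μ))
P-∑ d μ = begin
  P d μ
    ≡⟨ sumS-eval (map term (filterᵇ divides (upTo d))) μ ⟩
  sumℚ (map (λ F → F μ) (map term (filterᵇ divides (upTo d))))
    ≡⟨ sumℚ-map-map (λ F → F μ) term (filterᵇ divides (upTo d)) ⟩
  sumℚ (map (λ k → term k μ) (filterᵇ divides (upTo d)))
    ≡⟨ sumℚ-filterᵇ (upTo d) ⟩
  sumℚ (map (P-term d (monoType μ)) (upTo d))
    ≡⟨ sumℚ-upTo (P-term d (monoType μ)) d ⟩
  ∑ d (P-term d (monoType μ)) ∎
  where
  open ≡-Reasoning
  divides : ℕ → Bool
  divides k = does (suc k ∣? d)
  term : ℕ → Series
  term k = ℕtoℚ (suc k) · M ((suc k , d / suc k) ∷ [])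
  sumℚ-filterᵇ : ∀ ks → sumℚ (map (λ k → term k μ) (filterᵇ divides ks)) ≡ sumℚ (map (P-term d (monoType μ)) ks)
  sumℚ-filterᵇ []       = refl
  sumℚ-filterᵇ (k ∷ ks) with suc k ∣? d in eq
  ... | yes k+1∣d = trans (cong (sumℚ ∘ map (λ k → term k μ))
                                (Listₚ.filter-accept (T? ∘ divides) (subst Bool.T (sym (cong does eq)) _)))
                          (cong (term k μ +_) (sumℚ-filterᵇ ks))
  ... | no k+1∤d  = trans (cong (sumℚ ∘ map (λ k → term k μ))
                                (Listₚ.filter-reject (T? ∘ divides) (subst Bool.T (cong does eq))))
                          (trans (sumℚ-filterᵇ ks) (sym (ℚₚ.+-identityˡ _)))

P-term-0 : ∀ d T k → (suc k ∣ d → T ≢ (suc k , d / suc k) ∷ []) → P-term d T k ≡ 0ℚ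
P-term-0 d T k T≢ with suc k ∣? d
... | no _      = refl
... | yes k+1∣d with sameMultiset T ((suc k , d / suc k) ∷ []) | sameMultiset-reflects T ((suc k , d / suc k) ∷ [])
...   | true  | ofʸ T≋ = contradiction (≋-[ _ ] T≋) (T≢ k+1∣d)
...   | false | _      = ℚₚ.*-zeroʳ (ℕtoℚ (suc k))

∑-P-term : ∀ d T → All PositiveStack T → ∑ d (P-term d T) ≡ gate (sumBy weight T ≡ᵇ d) (pgen T)
∑-P-term d [] _ = trans (∑-zero d (λ k → P-term-0 d [] k (λ _ ()))) (sym (gate-0ℚ _))
∑-P-term d (s ∷ t ∷ T) _ = trans (∑-zero d (λ k → P-term-0 d (s ∷ t ∷ T) k (λ _ ()))) (sym (gate-0ℚ _))
∑-P-term d ((suc c , e) ∷ []) ((_ , 1≤e) ∷ []) with suc c ℕ.* e ℕ.+ 0 ℕ.≟ d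
... | no ce≢d = trans (∑-zero d (λ k → P-term-0 d ((suc c , e) ∷ []) k (λ { k+1∣d refl → ce≢d (trans (ℕₚ.+-identityʳ _) (DivMod.m*[n/m]≡n k+1∣d)) })))
                      (sym (cong (λ b → gate b (ℕtoℚ (suc c))) (Dec.dec-false (suc c ℕ.* e ℕ.+ 0 ℕ.≟ d) ce≢d)))
... | yes ce≡d = trans (∑-single d c (P-term d T) c<d others) (trans at-c
                       (sym (cong (λ b → gate b (ℕtoℚ (suc c))) (Dec.dec-true (suc c ℕ.* e ℕ.+ 0 ℕ.≟ d) ce≡d))))
  where
  T : List Stack
  T = (suc c , e) ∷ []
  d≡ce : d ≡ suc c ℕ.* e
  d≡ce = trans (sym ce≡d) (ℕₚ.+-identityʳ _)
  c<d : c < d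
  c<d = subst (c <_) (sym d≡ce) (ℕₚ.m≤m*n (suc c) e {{ℕ.>-nonZero 1≤e}})
  others : ∀ k → k < d → k ≢ c → P-term d T k ≡ 0ℚ
  others k _ k≢c = P-term-0 d T k (λ _ T≡ → k≢c (ℕₚ.suc-injective (sym (cong proj₁ (proj₁ (Listₚ.∷-injective T≡))))))
  at-c : P-term d T c ≡ ℕtoℚ (suc c)
  at-c with suc c ∣? d
  ... | no c+1∤d = contradiction (subst (suc c ∣_) (sym d≡ce) (m∣m*n e)) c+1∤d
  ... | yes _ rewrite trans (cong (_/ suc c) (trans d≡ce (ℕₚ.*-comm (suc c) e))) (DivMod.m*n/n≡m e (suc c))
    with sameMultiset T T | sameMultiset-reflects T T
  ...   | true  | _      = ℚₚ.*-identityʳ (ℕtoℚ (suc c))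
  ...   | false | ofⁿ ¬≋ = contradiction (λ _ → refl) ¬≋

P-homPart : ∀ d μ → Valid μ → P d μ ≡ homPart d Pgen μ
P-homPart d μ v = begin
  P d μ                                                                    ≡⟨ P-∑ d μ ⟩
  ∑ d (P-term d (monoType μ))                                              ≡⟨ ∑-P-term d (monoType μ) (monoType-positive μ v) ⟩
  gate (sumBy weight (monoType μ) ≡ᵇ d) (pgen (monoType μ))               ≡⟨ cong₂ (λ n x → gate (n ≡ᵇ d) x)
                                                                                  (sumBy-weight-monoType μ) (sym (Pgen-monoType μ)) ⟩
  homPart d Pgen μ                                                         ∎
  where open ≡-Reasoning

-- The multinomial expansion

multinomialℚ : ℕ → List ℕ → ℚ
multinomialℚ K λ′ = ℕtoℚ (multinomial (length λ′) (multiplicities K λ′))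

prodS-replicate : ∀ (A : ℕ → Series) a x l → prodS (map A (replicate a x ++ l)) ≗ ((A x ^ a) ⊗ prodS (map A l))
prodS-replicate A zero    x l μ = sym (⊗-identityˡ (prodS (map A l)) μ)
prodS-replicate A (suc a) x l μ = trans (⊗-congʳ (A x) (prodS-replicate A a x l) μ) (sym (⊗-assoc (A x) (A x ^ a) (prodS (map A l)) μ))

⊗-sumℚʳ : ∀ {I : Set} F (G : I → Series) is μ → sumℚ (map (λ i → (F ⊗ G i) μ) is) ≡ (F ⊗ (λ ν → sumℚ (map (λ i → G i ν) is))) μ
⊗-sumℚʳ F G is μ = trans (sumℚ-swap (λ i (ν , ρ) → F ν * G i ρ) is (splits μ))
                         (sumℚ-cong (splits μ) (λ (ν , ρ) → sym (sumℚ-*ˡ (F ν) (λ i → G i ρ) is)))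

-- overPartitions c f n k sums c(ℓ(λ)) (ℓ(λ); m₁(λ), m₂(λ), …) A_{λ₁} ⋯ A_{λ_ℓ} over the partitions λ of n
-- with parts ≤ k, enumerated as sp f n (unitStacks k); in degree n it is ∑_ℓ c(ℓ) (A₁ + ⋯ + A_k)^ℓ.
module MultinomialExpansion (A : ℕ → Series) (A-homogeneous : ∀ k → Homogeneous k (A k)) (K : ℕ) where

  S : ℕ → Series
  S k = ∑S k (A ∘ suc)

  term : (ℕ → ℚ) → List ℕ → Series
  term c λ′ = (c (length λ′) * multinomialℚ K λ′) · prodS (map A λ′)

  overPartitions : (ℕ → ℚ) → ℕ → ℕ → ℕ → Series
  overPartitions c f n k μ = sumℚ (map (λ τ → term c (map proj₁ τ) μ) (sp f n (unitStacks k)))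

  overPowers : (ℕ → ℚ) → ℕ → ℕ → Series
  overPowers c N k μ = ∑ (suc N) (λ ℓ → c ℓ * (S k ^ ℓ) μ)

  S-suc : ∀ k → S (suc k) ≗ (A (suc k) ⊕ S k)
  S-suc k μ = trans (∑-last k (λ i → A (suc i) μ)) (ℚₚ.+-comm (S k μ) (A (suc k) μ))

  shift : (ℕ → ℚ) → ℕ → ℕ → ℚ
  shift c a b = c (a ℕ.+ b) * ℕtoℚ ((a ℕ.+ b) C a)

  term-replicate : ∀ c k a τ → suc k ≤ K → All (UnitStack k) τ → ∀ μ →
    term c (replicate a (suc k) ++ map proj₁ τ) μ ≡ ((A (suc k) ^ a) ⊗ term (shift c a) (map proj₁ τ)) μ
  term-replicate c k a τ k<K units μ = begin
    (c (length (replicate a (suc k) ++ λ′)) * multinomialℚ K (replicate a (suc k) ++ λ′)) * prodS (map A (replicate a (suc k) ++ λ′)) μ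
      ≡⟨ cong₂ (λ ℓ x → (c ℓ * ℕtoℚ (multinomial ℓ (multiplicities K (replicate a (suc k) ++ λ′)))) * x)
               (trans (Listₚ.length-++ (replicate a (suc k))) (cong (ℕ._+ ℓ′) (Listₚ.length-replicate a)))
               (prodS-replicate A a (suc k) λ′ μ) ⟩
    (c (a ℕ.+ ℓ′) * ℕtoℚ (multinomial (a ℕ.+ ℓ′) (multiplicities K (replicate a (suc k) ++ λ′)))) * ((A (suc k) ^ a) ⊗ prodS (map A λ′)) μ
      ≡⟨ cong (λ x → (c (a ℕ.+ ℓ′) * x) * ((A (suc k) ^ a) ⊗ prodS (map A λ′)) μ)
              (trans (cong ℕtoℚ (multinomial-replicate K k a λ′ k<K λ′-inRange k∉λ′))
                     (ℕtoℚ-* ((a ℕ.+ ℓ′) C a) (multinomial ℓ′ (multiplicities K λ′)))) ⟩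
    (c (a ℕ.+ ℓ′) * (ℕtoℚ ((a ℕ.+ ℓ′) C a) * multinomialℚ K λ′)) * ((A (suc k) ^ a) ⊗ prodS (map A λ′)) μ
      ≡⟨ cong (_* ((A (suc k) ^ a) ⊗ prodS (map A λ′)) μ) (ℚₚ.*-assoc (c (a ℕ.+ ℓ′)) _ (multinomialℚ K λ′)) ⟨
    (shift c a ℓ′ * multinomialℚ K λ′) * ((A (suc k) ^ a) ⊗ prodS (map A λ′)) μ
      ≡⟨ ⊗-·ʳ (shift c a ℓ′ * multinomialℚ K λ′) (A (suc k) ^ a) (prodS (map A λ′)) μ ⟨
    ((A (suc k) ^ a) ⊗ term (shift c a) λ′) μ ∎
    where
    open ≡-Reasoning
    λ′ : List ℕ
    λ′ = map proj₁ τ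
    ℓ′ : ℕ
    ℓ′ = length λ′
    λ′-inRange : All (InRange K) λ′
    λ′-inRange = Allₚ.map⁺ (All.map (λ (_ , 1≤i , i≤k) → 1≤i , ℕₚ.≤-trans i≤k (ℕₚ.≤-trans (ℕₚ.n≤1+n k) k<K)) units)
    k∉λ′ : mult (suc k) λ′ ≡ 0
    k∉λ′ = ∉⇒mult≡0 λ′ (λ k∈ → ℕₚ.<⇒≱ (s≤s ℕₚ.≤-refl) (All.lookup (Allₚ.map⁺ (All.map (proj₂ ∘ proj₂) units)) k∈))

  power-expansion : ∀ c k ℓ μ →
    c ℓ * (S (suc k) ^ ℓ) μ ≡ ∑ (suc ℓ) (λ a → shift c a (ℓ ∸ a) * ((A (suc k) ^ a) ⊗ (S k ^ (ℓ ∸ a))) μ)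
  power-expansion c k ℓ μ = begin
    c ℓ * (S (suc k) ^ ℓ) μ
      ≡⟨ cong (c ℓ *_) (trans (^-cong ℓ (S-suc k) μ) (binomial ℓ (A (suc k)) (S k) μ)) ⟩
    c ℓ * ∑ (suc ℓ) (λ a → ℕtoℚ (ℓ C a) * ((A (suc k) ^ a) ⊗ (S k ^ (ℓ ∸ a))) μ)
      ≡⟨ ∑-*ˡ (suc ℓ) (c ℓ) (λ a → ℕtoℚ (ℓ C a) * ((A (suc k) ^ a) ⊗ (S k ^ (ℓ ∸ a))) μ) ⟩
    ∑ (suc ℓ) (λ a → c ℓ * (ℕtoℚ (ℓ C a) * ((A (suc k) ^ a) ⊗ (S k ^ (ℓ ∸ a))) μ))
      ≡⟨ ∑-cong< (suc ℓ) (λ a a≤ℓ → trans (sym (ℚₚ.*-assoc (c ℓ) _ _))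
           (cong (λ n → (c n * ℕtoℚ (n C a)) * ((A (suc k) ^ a) ⊗ (S k ^ (ℓ ∸ a))) μ) (sym (ℕₚ.m+[n∸m]≡n (ℕₚ.≤-pred a≤ℓ))))) ⟩
    ∑ (suc ℓ) (λ a → shift c a (ℓ ∸ a) * ((A (suc k) ^ a) ⊗ (S k ^ (ℓ ∸ a))) μ) ∎
    where open ≡-Reasoning

  1≤weight : ∀ k → 1 ≤ weight (suc k , 1)
  1≤weight k = subst (1 ≤_) (sym (ℕₚ.*-identityʳ (suc k))) (s≤s z≤n)

  ^-homogeneous-weight : ∀ k a → Homogeneous (a ℕ.* weight (suc k , 1)) (A (suc k) ^ a)
  ^-homogeneous-weight k = ^-homogeneous (subst (λ n → Homogeneous n (A (suc k))) (sym (ℕₚ.*-identityʳ (suc k))) (A-homogeneous (suc k)))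

  block-overflows : ∀ c k f n N μ a → degree μ ≡ n → ¬ a ℕ.* weight (suc k , 1) ≤ n →
    multiplicityBlock (λ τ → term c (map proj₁ τ) μ) f (suc k , 1) (unitStacks k) n a
      ≡ ∑ (suc (N ∸ a)) (λ b → shift c a b * ((A (suc k) ^ a) ⊗ (S k ^ b)) μ)
  block-overflows c k f n N μ a deg≡n aw≰n =
    trans (multiplicityBlock-overflows (λ τ → term c (map proj₁ τ) μ) f (suc k , 1) (unitStacks k) n a aw≰n) (sym (∑-zero (suc (N ∸ a)) (λ b →
      trans (cong (shift c a b *_) (⊗-homogeneous-below (S k ^ b) μ (^-homogeneous-weight k a)
                                     (subst (ℕ._< a ℕ.* weight (suc k , 1)) (sym deg≡n) (ℕₚ.≰⇒> aw≰n))))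
            (ℚₚ.*-zeroʳ (shift c a b)))))

  block-fits : ∀ c k → suc k ≤ K → ∀ f n N μ a → Valid μ → degree μ ≡ n → (aw≤n : a ℕ.* weight (suc k , 1) ≤ n) →
    overPartitions (shift c a) f (n ∸ a ℕ.* weight (suc k , 1)) k ≈[ n ∸ a ℕ.* weight (suc k , 1) ]
      overPowers (shift c a) (N ∸ a) k →
    multiplicityBlock (λ τ → term c (map proj₁ τ) μ) f (suc k , 1) (unitStacks k) n a
      ≡ ∑ (suc (N ∸ a)) (λ b → shift c a b * ((A (suc k) ^ a) ⊗ (S k ^ b)) μ)
  block-fits c k k<K f n N μ a v deg≡n aw≤n IH = begin
    multiplicityBlock (λ τ → term c (map proj₁ τ) μ) f s (unitStacks k) n a
      ≡⟨ multiplicityBlock-fits (λ τ → term c (map proj₁ τ) μ) f s (unitStacks k) n a aw≤n ⟩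
    sumℚ (map (λ τ → term c (map proj₁ (replicate a s ++ τ)) μ) (sp f n′ (unitStacks k)))
      ≡⟨ sumℚ-congAll (All.map (λ {τ} units → trans
           (cong (λ λ′ → term c λ′ μ) (trans (Listₚ.map-++ proj₁ (replicate a s) τ)
                                              (cong (_++ map proj₁ τ) (Listₚ.map-replicate proj₁ a s))))
           (term-replicate c k a τ k<K units μ))
         (sp-All f n′ (unitStacks k) (unitStacks-unit k))) ⟩
    sumℚ (map (λ τ → ((A (suc k) ^ a) ⊗ term (shift c a) (map proj₁ τ)) μ) (sp f n′ (unitStacks k)))
      ≡⟨ ⊗-sumℚʳ (A (suc k) ^ a) (λ τ → term (shift c a) (map proj₁ τ)) (sp f n′ (unitStacks k)) μ ⟩
    ((A (suc k) ^ a) ⊗ overPartitions (shift c a) f n′ k) μ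
      ≡⟨ ⊗-congʳ-≈[] (^-homogeneous-weight k a) IH μ v (trans deg≡n (sym (ℕₚ.m+[n∸m]≡n aw≤n))) ⟩
    ((A (suc k) ^ a) ⊗ ∑S (suc (N ∸ a)) (λ b → shift c a b · (S k ^ b))) μ
      ≡⟨ ⊗-∑Sʳ (A (suc k) ^ a) (suc (N ∸ a)) (λ b → shift c a b · (S k ^ b)) μ ⟩
    ∑ (suc (N ∸ a)) (λ b → ((A (suc k) ^ a) ⊗ (shift c a b · (S k ^ b))) μ)
      ≡⟨ ∑-cong (suc (N ∸ a)) (λ b → ⊗-·ʳ (shift c a b) (A (suc k) ^ a) (S k ^ b) μ) ⟩
    ∑ (suc (N ∸ a)) (λ b → shift c a b * ((A (suc k) ^ a) ⊗ (S k ^ b)) μ) ∎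
    where
    open ≡-Reasoning
    s : Stack
    s = (suc k , 1)
    n′ : ℕ
    n′ = n ∸ a ℕ.* weight s

  expansion : ∀ k → k ≤ K → ∀ c f n N → n ≤ f → n ≤ N → overPartitions c f n k ≈[ n ] overPowers c N k
  expansion zero _ c f zero N _ _ μ _ _ = begin
    (c 0 * multinomialℚ K []) * oneS μ + 0ℚ
      ≡⟨ cong (λ x → (c 0 * ℕtoℚ x) * oneS μ + 0ℚ) (multinomial-[] K) ⟩
    (c 0 * 1ℚ) * oneS μ + 0ℚ
      ≡⟨ cong₂ _+_ (cong (_* oneS μ) (ℚₚ.*-identityʳ (c 0))) (sym (∑-zero N higher-powers)) ⟩
    overPowers c N 0 μ ∎
    where
    open ≡-Reasoning
    higher-powers : ∀ l → c (suc l) * (S 0 ^ suc l) μ ≡ 0ℚ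
    higher-powers l = trans (cong (c (suc l) *_) (⊗-zeroˡ (S 0 ^ l) μ)) (ℚₚ.*-zeroʳ (c (suc l)))
  expansion zero _ c (suc f) (suc n) N _ _ μ _ deg≡ = sym (trans
    (cong₂ _+_ (trans (cong (c 0 *_) (oneS-homogeneous μ (ℕₚ.1+n≢0 ∘ trans (sym deg≡)))) (ℚₚ.*-zeroʳ (c 0)))
               (∑-zero N (λ l → trans (cong (c (suc l) *_) (⊗-zeroˡ (S 0 ^ l) μ)) (ℚₚ.*-zeroʳ (c (suc l))))))
    (ℚₚ.+-identityʳ 0ℚ))
  expansion (suc k) k<K c f n N n≤f n≤N μ v deg≡n = begin
    overPartitions c f n (suc k) μ
      ≡⟨ sumℚ-sp-byMultiplicity g f n s (unitStacks k) (suc N) (1≤weight k) (unitStacks-positive k) n≤f (s≤s n≤N) ⟩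
    ∑ (suc N) (multiplicityBlock g f s (unitStacks k) n)
      ≡⟨ ∑-cong (suc N) (λ a → [ fits a , block-overflows c k f n N μ a deg≡n ]′ (Dec.toSum (a ℕ.* weight s ℕ.≤? n))) ⟩
    ∑ (suc N) (λ a → ∑ (suc (N ∸ a)) (λ b → T a b (N ∸ a ∸ b)))
      ≡⟨ ∑-triangle N T ⟨
    ∑ (suc N) (λ ℓ → ∑ (suc ℓ) (λ a → T a (ℓ ∸ a) (N ∸ ℓ)))
      ≡⟨ ∑-cong (suc N) (λ ℓ → power-expansion c k ℓ μ) ⟨
    overPowers c N (suc k) μ ∎
    where
    open ≡-Reasoning
    s : Stack
    s = (suc k , 1)
    g : List Stack → ℚ
    g τ = term c (map proj₁ τ) μ
    T : ℕ → ℕ → ℕ → ℚ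
    T a b _ = shift c a b * ((A (suc k) ^ a) ⊗ (S k ^ b)) μ
    fits : ∀ a → a ℕ.* weight s ≤ n → multiplicityBlock g f s (unitStacks k) n a ≡ ∑ (suc (N ∸ a)) (λ b → T a b (N ∸ a ∸ b))
    fits a aw≤n = block-fits c k k<K f n N μ a v deg≡n aw≤n
      (expansion k (ℕₚ.≤-trans (ℕₚ.n≤1+n k) k<K) (shift c a) f (n ∸ a ℕ.* weight s) (N ∸ a)
                 (ℕₚ.≤-trans (ℕₚ.m∸n≤m n (a ℕ.* weight s)) n≤f)
                 (ℕₚ.≤-trans (ℕₚ.∸-monoʳ-≤ n (ℕₚ.m≤m*n a (weight s) {{ℕ.>-nonZero (1≤weight k)}})) (ℕₚ.∸-monoˡ-≤ a n≤N)))

-- Power sums in terms of H and E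

homPart-cong : ∀ n {F G} μ → (degree μ ≡ n → F μ ≡ G μ) → homPart n F μ ≡ homPart n G μ
homPart-cong n {F} {G} μ F≡G =
  homPart-intro n G μ (λ deg≡n → trans (homPart-≡ n F μ deg≡n) (F≡G deg≡n)) (homPart-homogeneous n F μ)

sumBy-weight-units : ∀ d τ → All (UnitStack d) τ → sumBy weight τ ≡ sum (map proj₁ τ)
sumBy-weight-units d []             []                 = refl
sumBy-weight-units d ((i , .1) ∷ τ) ((refl , _) ∷ units) = cong₂ ℕ._+_ (ℕₚ.*-identityʳ i) (sumBy-weight-units d τ units)

-- Applied to (B , Fam , s) = (Hgen , H , 1) and (Egen , E , -1).
module PowerSumExpansion (B : Series) (Fam : ℕ → Series) (s : ℚ)
  (Fam≈homPart : ∀ k μ → Valid μ → Fam k μ ≡ homPart k B μ)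
  (B≡1 : ∀ μ → exponentSum μ ≡ 0 → B μ ≡ 1ℚ)
  (D-B : D B ≗ (s · (Pgen ⊗ B)))
  (s*s≡1 : s * s ≡ 1ℚ)
  (d : ℕ) where

  X : Series
  X = B ⊕ ((- 1ℚ) · oneS)

  B≗1+X : B ≗ (oneS ⊕ X)
  B≗1+X μ = solve 2 (λ o b → b := o :+ (b :+ (:- con 1ℚ) :* o)) refl (oneS μ) (B μ)

  X-vanishesBelow-1 : VanishesBelow 1 X
  X-vanishesBelow-1 μ e<1 = cong₂ (λ b o → b + (- 1ℚ) * o) (B≡1 μ e≡0) (oneS-exponentSum0 μ e≡0)
    where
    e≡0 : exponentSum μ ≡ 0
    e≡0 = ℕₚ.n<1⇒n≡0 e<1

  open LogarithmicDerivative B X s B≗1+X X-vanishesBelow-1 D-B using (log-expansion)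

  A : ℕ → Series
  A k = homPart k B

  open MultinomialExpansion A (λ k → homPart-homogeneous k B) d using (S; overPowers; expansion)

  S≈X : S d ≈[≤ d ] X
  S≈X μ v deg≤d with degree μ ℕ.≟ 0
  ... | yes deg≡0 = trans (∑-zero d (λ i → homPart-homogeneous (suc i) B μ (ℕₚ.0≢1+n ∘ trans (sym deg≡0))))
                          (sym (X-vanishesBelow-1 μ (s≤s (subst (exponentSum μ ≤_) deg≡0 (exponentSum≤degree μ v)))))
  ... | no deg≢0 = begin
    S d μ                  ≡⟨ ∑-single d c (λ i → A (suc i) μ) c<d (λ i _ i≢c →
                                homPart-homogeneous (suc i) B μ (λ deg≡1+i → i≢c (sym (ℕₚ.suc-injective (trans (sym deg≡1+c) deg≡1+i))))) ⟩
    A (suc c) μ            ≡⟨ homPart-≡ (suc c) B μ deg≡1+c ⟩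
    B μ                    ≡⟨ ℚₚ.+-identityʳ (B μ) ⟨
    B μ + 0ℚ               ≡⟨ cong (λ z → B μ + z) (trans (cong ((- 1ℚ) *_) (oneS-homogeneous μ deg≢0)) (ℚₚ.*-zeroʳ (- 1ℚ))) ⟨
    X μ                    ∎
    where
    open ≡-Reasoning
    c : ℕ
    c = degree μ ∸ 1
    deg≡1+c : degree μ ≡ suc c
    deg≡1+c = sym (ℕₚ.suc-pred (degree μ) {{ℕ.≢-nonZero deg≢0}})
    c<d : c < d
    c<d = subst (_≤ d) deg≡1+c deg≤d

  S^≈X^ : ∀ ℓ → (S d ^ ℓ) ≈[≤ d ] (X ^ ℓ)
  S^≈X^ zero    μ _ _ = refl
  S^≈X^ (suc ℓ) = ⊗-cong-≈[≤] {d} {S d} {X} {S d ^ ℓ} {X ^ ℓ} S≈X (S^≈X^ ℓ)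

  prodS-Fam≈A : ∀ λ′ μ → Valid μ → prodS (map Fam λ′) μ ≡ prodS (map A λ′) μ
  prodS-Fam≈A λ′ μ v = go λ′ μ v ℕₚ.≤-refl
    where
    go : ∀ λ′ → prodS (map Fam λ′) ≈[≤ degree μ ] prodS (map A λ′)
    go []        ν _ _ = refl
    go (k ∷ λ′) = ⊗-cong-≈[≤] {degree μ} {Fam k} {A k} (λ ν v _ → Fam≈homPart k ν v) (go λ′)

  prodS-A-homogeneous : ∀ λ′ → Homogeneous (sum λ′) (prodS (map A λ′))
  prodS-A-homogeneous []       = oneS-homogeneous
  prodS-A-homogeneous (k ∷ λ′) = ⊗-homogeneous (homPart-homogeneous k B) (prodS-A-homogeneous λ′)

  partitions-expansion : ∀ (c : ℕ → ℚ) μ → Valid μ →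
    sumS (map (λ λ′ → (c (length λ′) * coeff d λ′) · prodS (map Fam λ′)) (partitions d)) μ
      ≡ homPart d (λ ν → ∑ (suc d) (λ ℓ → (c ℓ * frac d ℓ) * (X ^ ℓ) ν)) μ
  partitions-expansion c μ v = trans (sumS-partitions d (λ λ′ → (c (length λ′) * coeff d λ′) · prodS (map Fam λ′)) μ)
                                     (homPart-intro d (λ ν → ∑ (suc d) (λ ℓ → c′ ℓ * (X ^ ℓ) ν)) μ on-degree off-degree)
    where
    open ≡-Reasoning
    c′ : ℕ → ℚ
    c′ ℓ = c ℓ * frac d ℓ
    term : List ℕ → ℚ
    term λ′ = (c (length λ′) * coeff d λ′) * prodS (map Fam λ′) μ
    term≡ : ∀ λ′ → term λ′ ≡ (c′ (length λ′) * multinomialℚ d λ′) * prodS (map A λ′) μ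
    term≡ λ′ = cong₂ _*_ (sym (ℚₚ.*-assoc (c (length λ′)) (frac d (length λ′)) (multinomialℚ d λ′))) (prodS-Fam≈A λ′ μ v)
    on-degree : degree μ ≡ d → sumℚ (map (term ∘ map proj₁) (sp d d (unitStacks d))) ≡ ∑ (suc d) (λ ℓ → c′ ℓ * (X ^ ℓ) μ)
    on-degree deg≡d = begin
      sumℚ (map (term ∘ map proj₁) (sp d d (unitStacks d)))
        ≡⟨ sumℚ-cong (sp d d (unitStacks d)) (term≡ ∘ map proj₁) ⟩
      MultinomialExpansion.overPartitions A (λ k → homPart-homogeneous k B) d c′ d d d μ
        ≡⟨ expansion d ℕₚ.≤-refl c′ d d d ℕₚ.≤-refl ℕₚ.≤-refl μ v deg≡d ⟩
      overPowers c′ d d μ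
        ≡⟨ ∑-cong (suc d) (λ ℓ → cong (c′ ℓ *_) (S^≈X^ ℓ μ v (ℕₚ.≤-reflexive deg≡d))) ⟩
      ∑ (suc d) (λ ℓ → c′ ℓ * (X ^ ℓ) μ) ∎
    off-degree : degree μ ≢ d → sumℚ (map (term ∘ map proj₁) (sp d d (unitStacks d))) ≡ 0ℚ
    off-degree deg≢d =
      trans (sumℚ-congAll (All.map (λ {τ} → vanishing τ)
                                   (All.zipWith id (sp-All d d (unitStacks d) (unitStacks-unit d) , sp-weight d d (unitStacks d)))))
            (sumℚ-zero (sp d d (unitStacks d)) (λ _ → refl))
      where
      vanishing : ∀ τ → All (UnitStack d) τ × sumBy weight τ ≡ d → term (map proj₁ τ) ≡ 0ℚ
      vanishing τ (units , weight≡d) = trans (term≡ λ′)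
        (trans (cong (c′ (length λ′) * multinomialℚ d λ′ *_) (prodS-A-homogeneous λ′ μ deg≢sum))
               (ℚₚ.*-zeroʳ (c′ (length λ′) * multinomialℚ d λ′)))
        where
        λ′ : List ℕ
        λ′ = map proj₁ τ
        deg≢sum : degree μ ≢ sum λ′
        deg≢sum deg≡ = deg≢d (trans deg≡ (trans (sym (sumBy-weight-units d τ units)) weight≡d))

  P-expansion : ∀ (c : ℕ → ℚ) → (∀ l → c (suc l) ≡ s * sign l) → ∀ μ → Valid μ →
    P d μ ≡ sumS (map (λ λ′ → (c (length λ′) * coeff d λ′) · prodS (map Fam λ′)) (partitions d)) μ
  P-expansion c c≡s*sign μ v = begin
    P d μ                                                                  ≡⟨ P-homPart d μ v ⟩
    homPart d Pgen μ                                                       ≡⟨ homPart-cong d {Pgen} {λ ν → ∑ (suc d) (λ ℓ → (c ℓ * frac d ℓ) * (X ^ ℓ) ν)} μ Pgen≡ ⟩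
    homPart d (λ ν → ∑ (suc d) (λ ℓ → (c ℓ * frac d ℓ) * (X ^ ℓ) ν)) μ    ≡⟨ partitions-expansion c μ v ⟨
    sumS (map (λ λ′ → (c (length λ′) * coeff d λ′) · prodS (map Fam λ′)) (partitions d)) μ ∎
    where
    open ≡-Reasoning
    coefficient : ∀ ℓ x → s * ((sign (ℓ ∸ 1) * frac d ℓ) * x) ≡ (c ℓ * frac d ℓ) * x
    coefficient zero    x = solve 4 (λ s a b x → s :* ((a :* con 0ℚ) :* x) := (b :* con 0ℚ) :* x) refl s 1ℚ (c 0) x
    coefficient (suc l) x = trans (solve 4 (λ s a f x → s :* ((a :* f) :* x) := ((s :* a) :* f) :* x) refl s (sign l) (frac d (suc l)) x)
                                  (cong (λ z → (z * frac d (suc l)) * x) (sym (c≡s*sign l)))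
    Pgen≡ : degree μ ≡ d → Pgen μ ≡ ∑ (suc d) (λ ℓ → (c ℓ * frac d ℓ) * (X ^ ℓ) μ)
    Pgen≡ deg≡d = begin
      Pgen μ                                                              ≡⟨ ℚₚ.*-identityˡ (Pgen μ) ⟨
      1ℚ * Pgen μ                                                         ≡⟨ cong (_* Pgen μ) s*s≡1 ⟨
      s * s * Pgen μ                                                      ≡⟨ ℚₚ.*-assoc s s (Pgen μ) ⟩
      s * (s * Pgen μ)                                                    ≡⟨ cong (s *_) (log-expansion d μ size≤d) ⟨
      s * ∑ (suc d) (λ ℓ → (sign (ℓ ∸ 1) * frac (degree μ) ℓ) * (X ^ ℓ) μ) ≡⟨ cong (λ n → s * ∑ (suc d) (λ ℓ → (sign (ℓ ∸ 1) * frac n ℓ) * (X ^ ℓ) μ)) deg≡d ⟩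
      s * ∑ (suc d) (λ ℓ → (sign (ℓ ∸ 1) * frac d ℓ) * (X ^ ℓ) μ)         ≡⟨ ∑-*ˡ (suc d) s (λ ℓ → (sign (ℓ ∸ 1) * frac d ℓ) * (X ^ ℓ) μ) ⟩
      ∑ (suc d) (λ ℓ → s * ((sign (ℓ ∸ 1) * frac d ℓ) * (X ^ ℓ) μ))       ≡⟨ ∑-cong (suc d) (λ ℓ → coefficient ℓ ((X ^ ℓ) μ)) ⟩
      ∑ (suc d) (λ ℓ → (c ℓ * frac d ℓ) * (X ^ ℓ) μ)                      ∎
      where
      size≤d : exponentSum μ ≤ d
      size≤d = subst (exponentSum μ ≤_) deg≡d (exponentSum≤degree μ v)

substPow-expansion : ∀ k {F} (Fam : ℕ → Series) (c : List ℕ → ℚ) λs →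
  (∀ μ → Valid μ → F μ ≡ sumS (map (λ λ′ → c λ′ · prodS (map Fam λ′)) λs) μ) →
  substPow (suc k) F ≈S sumS (map (λ λ′ → c λ′ · atStack Fam (suc k) λ′) λs)
substPow-expansion k {F} Fam c λs F≈ μ (valid , _) = begin
  substPow (suc k) F μ
    ≡⟨ substPow-cong-Valid {F} F≈ μ (All.map proj₁ valid) ⟩
  substPow (suc k) (sumS (map (λ λ′ → c λ′ · prodS (map Fam λ′)) λs)) μ
    ≡⟨ go λs ⟩
  sumS (map (λ λ′ → c λ′ · atStack Fam (suc k) λ′) λs) μ ∎
  where
  open ≡-Reasoning
  open SubstPow k
  go : ∀ λs → substPow (suc k) (sumS (map (λ λ′ → c λ′ · prodS (map Fam λ′)) λs)) μ
              ≡ sumS (map (λ λ′ → c λ′ · atStack Fam (suc k) λ′) λs) μ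
  go []        = trans (substPow-eval zeroS μ) (gate-0ℚ (allDivisible μ))
  go (λ′ ∷ λs) = trans (substPow-⊕ (c λ′ · prodS (map Fam λ′)) (sumS (map (λ λ′ → c λ′ · prodS (map Fam λ′)) λs)) μ)
    (cong₂ _+_
       (trans (substPow-· (c λ′) (prodS (map Fam λ′)) μ)
              (cong (c λ′ *_) (trans (substPow-prodS (map Fam λ′) μ) (cong (λ Fs → prodS Fs μ) (sym (Listₚ.map-∘ λ′))))))
       (go λs))

P-via-H : ∀ d μ → Valid μ →
  P d μ ≡ sumS (map (λ λ′ → (sign (length λ′ ∸ 1) * coeff d λ′) · prodS (map H λ′)) (partitions d)) μ
P-via-H d = PowerSumExpansion.P-expansion Hgen H 1ℚ H-homPart (λ _ _ → refl) D-Hgen′ refl d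
              (λ ℓ → sign (ℓ ∸ 1)) (λ l → sym (ℚₚ.*-identityˡ (sign l)))
  where
  D-Hgen′ : D Hgen ≗ (1ℚ · (Pgen ⊗ Hgen))
  D-Hgen′ μ = trans (D-Hgen μ) (sym (ℚₚ.*-identityˡ ((Pgen ⊗ Hgen) μ)))

P-via-E : ∀ d μ → Valid μ →
  P d μ ≡ sumS (map (λ λ′ → (sign (length λ′) * coeff d λ′) · prodS (map E λ′)) (partitions d)) μ
P-via-E d = PowerSumExpansion.P-expansion Egen E (- 1ℚ) E-homPart Egen-exponentSum0 D-Egen refl d
              sign (λ l → solve 1 (λ x → :- x := (:- con 1ℚ) :* x) refl (sign l))

mainTheorem11 : (d m : ℕ) → 1 ≤ d → 1 ≤ m →
    (substPow m (P d)
    ≈S sumS (map (λ lam → (sign (length lam ∸ 1) * coeff d lam) · atStack H m lam) (partitions d)))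
    × (substPow m (P d)
    ≈S sumS (map (λ lam → (sign (length lam) * coeff d lam) · atStack E m lam) (partitions d)))
mainTheorem11 d (suc k) _ _ =
    substPow-expansion k H (λ λ′ → sign (length λ′ ∸ 1) * coeff d λ′) (partitions d) (P-via-H d)
  , substPow-expansion k E (λ λ′ → sign (length λ′) * coeff d λ′) (partitions d) (P-via-E d)
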